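{- Let $q$ be a prime power and $n\ge 1$. Let $A$ and $B$ be the Dickson matrices of the linearized polynomials $f(x)=\sum_{i=0}^{n-1}a_ix^{q^i}$ and $g(x)=\sum_{i=0}^{n-1}b_ix^{q^i}$ over $\mathbb{F}_{q^n}$, and suppose $A$ and $B$ are diagonally similar, i.e. $B=D^{ -1}AD$ for some invertible diagonal matrix $D$ over $\mathbb{F}_{q^n}$. Then $B=\mathrm{diag}(\lambda,\lambda^q,\dots,\lambda^{q^{n-1}})^{ -1}\,A\,\mathrm{diag}(\lambda,\lambda^q,\dots,\lambda^{q^{n-1}})$ for some $\lambda\in\mathbb{F}_{q^n}^*$, and $g(x)=\lambda^{ -1}f(\lambda x)$. Moreover, if $\mathbb{F}_{q'}$ (with $\mathbb{F}_q\subseteq\mathbb{F}_{q'}\subseteq\mathbb{F}_{q^n}$) is the maximum field of linearity of $f$ and $g$, then $\lambda$ is unique modulo $\mathbb{F}_{q'}^*$.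
   Context: The Dickson matrix of $f$ is the $n\times n$ matrix $A$ indexed by $\mathbb{Z}_n$ with $A[i|j]=a_{j-i}^{q^i}$. The maximum field of linearity of $f$ is $\mathbb{F}_{q^e}$ where $e$ is the largest divisor of $n$ such that $f$ is $\mathbb{F}_{q^e}$-linear. -}

module Defs where

open import Level using (Level; _⊔_; suc)
open import Algebra.Bundles using (CommutativeRing)
open import Data.Nat as ℕ using (ℕ; zero; NonZero; _≤_)
import Data.Nat
open import Data.Nat.Divisibility using (_∣_)
open import Data.Nat.Primality using (Prime)
open import Data.Nat.DivMod using (_mod_)
open import Data.Fin using (Fin; toℕ)
open import Data.Product using (Σ; ∃; _×_; _,_)
open import Relation.Nullary using (¬_)
open import Function.Bundles using (Inverse)
import Relation.Binary.PropositionalEquality as ≡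
import Algebra.Definitions.RawMonoid as RM

-- A field: a commutative ring with 0 ≠ 1 in which every nonzero element
-- has a multiplicative inverse (given by a total operation _⁻¹, whose value
-- at 0 is irrelevant).
record Field (c ℓ : Level) : Set (Level.suc (c ⊔ ℓ)) where
  field
    commutativeRing : CommutativeRing c ℓ
  open CommutativeRing commutativeRing public
  field
    _⁻¹      : Carrier → Carrier
    0≉1      : ¬ (0# ≈ 1#)
    inverseʳ : ∀ x → ¬ (x ≈ 0#) → (x * (x ⁻¹)) ≈ 1#

IsPrimePower : ℕ → Set
IsPrimePower q = Σ ℕ λ p → Σ ℕ λ k → Prime p × 1 ≤ k × q ≡.≡ p Data.Nat.^ k

module _ {c ℓ} (F : Field c ℓ) where
  open Field F

  HasCardinality : ℕ → Set (c ⊔ ℓ)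
  HasCardinality m = Inverse (≡.setoid (Fin m)) setoid

  pow : Carrier → ℕ → Carrier
  pow x zero = 1#
  pow x (ℕ.suc k) = x * pow x k

  sumF : ∀ {n} → (Fin n → Carrier) → Carrier
  sumF = RM.sum +-rawMonoid

  Matrix : ℕ → Set c
  Matrix n = Fin n → Fin n → Carrier

  _≈M_ : ∀ {n} → Matrix n → Matrix n → Set ℓ
  M ≈M N = ∀ i j → M i j ≈ N i j

  _*M_ : ∀ {n} → Matrix n → Matrix n → Matrix n
  (M *M N) i j = sumF (λ k → M i k * N k j)

  identityM : ∀ {n} → Matrix n
  identityM i j with i Data.Fin.≟ j
  ... | Relation.Nullary.yes _ = 1#
  ... | Relation.Nullary.no _ = 0#

  diag : ∀ {n} → (Fin n → Carrier) → Matrix n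
  diag d i j with i Data.Fin.≟ j
  ... | Relation.Nullary.yes _ = d i
  ... | Relation.Nullary.no _ = 0#

  IsDiagonal : ∀ {n} → Matrix n → Set ℓ
  IsDiagonal M = ∀ i j → ¬ (i ≡.≡ j) → M i j ≈ 0#

  IsInverse : ∀ {n} → Matrix n → Matrix n → Set ℓ
  IsInverse M N = ((M *M N) ≈M identityM) × ((N *M M) ≈M identityM)

  DiagonallySimilar : ∀ {n} → Matrix n → Matrix n → Set (c ⊔ ℓ)
  DiagonallySimilar A B =
    Σ (Matrix _) λ D → Σ (Matrix _) λ Dinv →
      IsDiagonal D × IsInverse D Dinv × (B ≈M ((Dinv *M A) *M D))

  module _ (q n : ℕ) .{{_ : NonZero n}} where

    linPoly : (Fin n → Carrier) → Carrier → Carrier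
    linPoly a x = sumF (λ i → a i * pow x (q Data.Nat.^ toℕ i))

    -- (j - i) mod n, indices in ℤ_n
    subMod : Fin n → Fin n → Fin n
    subMod j i = (toℕ j Data.Nat.+ (n Data.Nat.∸ toℕ i)) mod n

    dickson : (Fin n → Carrier) → Matrix n
    dickson a i j = pow (a (subMod j i)) (q Data.Nat.^ toℕ i)

    frobDiag : Carrier → Matrix n
    frobDiag λ' = diag (λ i → pow λ' (q Data.Nat.^ toℕ i))

    frobDiagInv : Carrier → Matrix n
    frobDiagInv λ' = diag (λ i → (pow λ' (q Data.Nat.^ toℕ i)) ⁻¹)

    InSubfield : ℕ → Carrier → Set ℓ
    InSubfield e c = pow c (q Data.Nat.^ e) ≈ c

    IsLinearOver : ℕ → (Carrier → Carrier) → Set (c ⊔ ℓ)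
    IsLinearOver e f =
      (∀ x y → f (x + y) ≈ (f x + f y)) ×
      (∀ c' x → InSubfield e c' → f (c' * x) ≈ (c' * f x))

    IsMaxFieldOfLinearity : ℕ → (Carrier → Carrier) → Set (c ⊔ ℓ)
    IsMaxFieldOfLinearity e f =
      e ∣ n × IsLinearOver e f × (∀ e' → e' ∣ n → IsLinearOver e' f → e' ≤ e)

module Submission where

-- With D = diag(d_i), the identity B = D⁻¹ A D reads  d_i b_(j-i)^(q^i) = a_(j-i)^(q^i) d_j.
-- Averaging it Frobenius-wise, λ = Σ_m (d_(-m) θ)^(q^m) satisfies  b_s λ = a_s λ^(q^s)  for all s,
-- which is both the conjugation of the Dickson matrices by diag(λ^(q^i)) and g(x) = λ⁻¹ f(λx);
-- θ is chosen so that λ ≠ 0, which is possible because a nonzero q-polynomial of degree below q^n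
-- cannot vanish on F_(q^n).  For uniqueness, ν = μ/λ commutes with f, and comparing coefficients of
-- f(νy) - ν f(y) gives ν^(q^s) = ν for every s in the support of f, i.e. ν ∈ F_(q^h) with
-- h = gcd(n, support).  This F_(q^h) is the maximum field of linearity: f is F_(q^h)-linear, and if e
-- did not divide a supported s, then F_(q^e) ⊆ F_(q^gcd(e,s)), which a trace argument rules out.

open import Defs
open import Level using (Level)
open import Data.Nat using (ℕ; NonZero)
open import Data.Fin using (Fin)
open import Data.Product using (Σ; _×_)
open import Relation.Nullary using (¬_)

import Data.Nat as Nat
open Nat using (zero; suc; z≤n; s≤s; _≤_; _<_; _!)
import Data.Nat.Properties as ℕP
open import Data.Nat.Divisibility as ℕD using (_∣_; _∤_; divides)
open import Data.Nat.Primality using (Prime; euclidsLemma; prime⇒nonZero; prime⇒nonTrivial)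
open import Data.Nat.Combinatorics using (_C_; nCn≡1; k![n∸k]!∣n!)
open import Data.Nat.Combinatorics.Specification using (nCk≡n!/k![n-k]!)
import Data.Nat.DivMod as ℕDM
open ℕDM using (_%_; _/_; _mod_)
open import Data.Nat.GCD using (gcd; gcd[m,n]∣m; gcd[m,n]∣n; gcd-greatest; gcd-GCD; module Bézout)
open import Data.Fin as Fin using (toℕ)
import Data.Fin.Properties as FinP
open import Data.Fin.Permutation using (Permutation; permutation)
open import Data.List as List using (List; []; _∷_; _++_; replicate; length)
import Data.List.Properties as ListP
open import Data.List.Relation.Unary.All using (All; []; _∷_)
open import Data.List.Relation.Unary.All.Properties using (++⁻ʳ)
open import Data.Product using (_,_; proj₁; proj₂)
open import Data.Sum using (inj₁; inj₂)
open import Data.Empty using (⊥-elim)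
open import Relation.Nullary using (Dec; yes; no)
import Relation.Nullary.Decidable as Dec
open import Function using (_∘_)
open import Function.Bundles using (Inverse)
import Algebra.Definitions.RawMonoid as RawMonoid
import Relation.Binary.PropositionalEquality as ≡
open ≡ using (_≡_; _≢_)

p∤m! : ∀ {p} → Prime p → ∀ m → m < p → p ∤ m !
p∤m! pp zero _ p∣1 with ℕD.∣1⇒≡1 p∣1 | prime⇒nonTrivial pp
... | ≡.refl | ()
p∤m! pp (suc m) m<p p∣m! with euclidsLemma (suc m) (m !) pp p∣m!
... | inj₁ p∣m = ℕP.<⇒≱ m<p (ℕD.∣⇒≤ p∣m)
... | inj₂ p∣m! = p∤m! pp m (ℕP.<-trans (ℕP.n<1+n m) m<p) p∣m!

p∣pCm : ∀ {p} → Prime p → ∀ {m} → 0 < m → m < p → p ∣ p C m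
p∣pCm {p} pp {m} 0<m m<p with euclidsLemma (p C m) (m ! Nat.* (p Nat.∸ m) !) pp p∣pCm*m!*[p∸m]!
  where
  instance _ = m ℕP.!* (p Nat.∸ m) !≢0
  p∣pCm*m!*[p∸m]! : p ∣ (p C m) Nat.* (m ! Nat.* (p Nat.∸ m) !)
  p∣pCm*m!*[p∸m]! = ≡.subst (p ∣_) (≡.sym p!≡pCm*m!*[p∸m]!) (n∣n! p (ℕP.<-trans 0<m m<p))
    where
    p!≡pCm*m!*[p∸m]! : (p C m) Nat.* (m ! Nat.* (p Nat.∸ m) !) ≡ p !
    p!≡pCm*m!*[p∸m]! = ≡.trans (≡.cong (Nat._* (m ! Nat.* (p Nat.∸ m) !)) (nCk≡n!/k![n-k]! (ℕP.<⇒≤ m<p)))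
                               (ℕDM.m/n*n≡m (k![n∸k]!∣n! (ℕP.<⇒≤ m<p)))
    n∣n! : ∀ r → 0 < r → r ∣ r !
    n∣n! (suc r) _ = ℕD.m∣m*n (r !)
... | inj₁ p∣pCm = p∣pCm
... | inj₂ p∣m!*[p∸m]! with euclidsLemma (m !) ((p Nat.∸ m) !) pp p∣m!*[p∸m]!
... | inj₁ p∣m! = ⊥-elim (p∤m! pp m m<p p∣m!)
... | inj₂ p∣[p∸m]! = ⊥-elim (p∤m! pp (p Nat.∸ m) (ℕP.∸-monoʳ-< 0<m (ℕP.<⇒≤ m<p)) p∣[p∸m]!)

∣⇒nonZero : ∀ {m n} .{{_ : NonZero n}} → m ∣ n → NonZero m
∣⇒nonZero {zero}  {n} 0∣n = ⊥-elim (Nat.≢-nonZero⁻¹ n (ℕD.0∣⇒≡0 0∣n))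
∣⇒nonZero {suc m}     _   = _

double : ℕ → ℕ
double zero    = 0
double (suc j) = suc (suc (double j))

module FieldProperties {c ℓ} (F : Field c ℓ) where
  open Field F
  open import Relation.Binary.Reasoning.Setoid setoid
  open import Algebra.Properties.Group +-group public using (∙-cancelˡ; x∙y⁻¹≈ε⇒x≈y; x≈y⇒x∙y⁻¹≈ε)
  open import Algebra.Properties.Monoid.Sum +-monoid using (sum-cong-≋; sum-replicate-zero)
  import Algebra.Solver.CommutativeMonoid *-commutativeMonoid as *-Solver

  infixr 8 _^_
  _^_ : Carrier → ℕ → Carrier
  _^_ = pow F

  ^-congˡ : ∀ {x y} m → x ≈ y → x ^ m ≈ y ^ m
  ^-congˡ zero    x≈y = refl
  ^-congˡ (suc m) x≈y = *-cong x≈y (^-congˡ m x≈y)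

  ^-congʳ : ∀ x {m k} → m ≡ k → x ^ m ≈ x ^ k
  ^-congʳ x ≡.refl = refl

  ^-homo-* : ∀ x m k → x ^ (m Nat.+ k) ≈ x ^ m * x ^ k
  ^-homo-* x zero    k = sym (*-identityˡ _)
  ^-homo-* x (suc m) k = trans (*-congˡ (^-homo-* x m k)) (sym (*-assoc _ _ _))

  ^-distrib-* : ∀ x y m → (x * y) ^ m ≈ x ^ m * y ^ m
  ^-distrib-* x y zero    = sym (*-identityˡ _)
  ^-distrib-* x y (suc m) = begin
    (x * y) * (x * y) ^ m     ≈⟨ *-congˡ (^-distrib-* x y m) ⟩
    (x * y) * (x ^ m * y ^ m) ≈⟨ *-Solver.solve 4 (λ a b c d → (a ⊕ b) ⊕ (c ⊕ d) ⊜ (a ⊕ c) ⊕ (b ⊕ d)) refl x y (x ^ m) (y ^ m) ⟩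
    (x * x ^ m) * (y * y ^ m) ∎
    where open *-Solver using (_⊕_; _⊜_)

  1^m≈1 : ∀ m → 1# ^ m ≈ 1#
  1^m≈1 zero    = refl
  1^m≈1 (suc m) = trans (*-identityˡ _) (1^m≈1 m)

  ^-*-assoc : ∀ x m k → (x ^ m) ^ k ≈ x ^ (m Nat.* k)
  ^-*-assoc x zero    k = 1^m≈1 k
  ^-*-assoc x (suc m) k = begin
    (x * x ^ m) ^ k         ≈⟨ ^-distrib-* x (x ^ m) k ⟩
    x ^ k * (x ^ m) ^ k     ≈⟨ *-congˡ (^-*-assoc x m k) ⟩
    x ^ k * x ^ (m Nat.* k) ≈⟨ ^-homo-* x k (m Nat.* k) ⟨
    x ^ (k Nat.+ m Nat.* k) ∎

  x^1≈x : ∀ x → x ^ 1 ≈ x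
  x^1≈x = *-identityʳ

  0^m≈0 : ∀ m .{{_ : NonZero m}} → 0# ^ m ≈ 0#
  0^m≈0 (suc m) = zeroˡ _

  1≉0 : 1# ≉ 0#
  1≉0 1≈0 = 0≉1 (sym 1≈0)

  inverseˡ : ∀ x → x ≉ 0# → x ⁻¹ * x ≈ 1#
  inverseˡ x x≉0 = trans (*-comm _ _) (inverseʳ x x≉0)

  *-cancelˡ : ∀ {x y z} → x ≉ 0# → x * y ≈ x * z → y ≈ z
  *-cancelˡ {x} {y} {z} x≉0 xy≈xz = begin
    y                ≈⟨ *-identityˡ y ⟨
    1# * y           ≈⟨ *-congʳ (inverseˡ x x≉0) ⟨
    (x ⁻¹ * x) * y   ≈⟨ *-assoc _ _ _ ⟩
    x ⁻¹ * (x * y)   ≈⟨ *-congˡ xy≈xz ⟩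
    x ⁻¹ * (x * z)   ≈⟨ *-assoc _ _ _ ⟨
    (x ⁻¹ * x) * z   ≈⟨ *-congʳ (inverseˡ x x≉0) ⟩
    1# * z           ≈⟨ *-identityˡ z ⟩
    z                ∎

  x*y≈0⇒y≈0 : ∀ {x y} → x ≉ 0# → x * y ≈ 0# → y ≈ 0#
  x*y≈0⇒y≈0 x≉0 xy≈0 = *-cancelˡ x≉0 (trans xy≈0 (sym (zeroʳ _)))

  *-≉0 : ∀ {x y} → x ≉ 0# → y ≉ 0# → x * y ≉ 0#
  *-≉0 x≉0 y≉0 xy≈0 = y≉0 (x*y≈0⇒y≈0 x≉0 xy≈0)

  ^-≉0 : ∀ {x} m → x ≉ 0# → x ^ m ≉ 0#
  ^-≉0 zero    x≉0 = 1≉0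
  ^-≉0 (suc m) x≉0 = *-≉0 x≉0 (^-≉0 m x≉0)

  x*y≈z⇒x≈y⁻¹*z : ∀ {x y z} → y ≉ 0# → x * y ≈ z → x ≈ y ⁻¹ * z
  x*y≈z⇒x≈y⁻¹*z {x} {y} {z} y≉0 xy≈z = begin
    x              ≈⟨ *-identityʳ x ⟨
    x * 1#         ≈⟨ *-congˡ (inverseʳ y y≉0) ⟨
    x * (y * y ⁻¹) ≈⟨ *-assoc _ _ _ ⟨
    (x * y) * y ⁻¹ ≈⟨ *-congʳ xy≈z ⟩
    z * y ⁻¹       ≈⟨ *-comm _ _ ⟩
    y ⁻¹ * z       ∎

  conjugates⇒ratio-scalar : (f g : Carrier → Carrier) → (∀ {x y} → x ≈ y → f x ≈ f y) → ∀ {λ′ μ} → λ′ ≉ 0# → μ ≉ 0# →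
                            (∀ x → g x ≈ λ′ ⁻¹ * f (λ′ * x)) → (∀ x → g x ≈ μ ⁻¹ * f (μ * x)) →
                            ∀ y → f ((μ * λ′ ⁻¹) * y) ≈ (μ * λ′ ⁻¹) * f y
  conjugates⇒ratio-scalar f g f-cong {λ′} {μ} λ′≉0 μ≉0 g≈f[λ′] g≈f[μ] y = begin
    f (ν * y)                       ≈⟨ *-identityˡ _ ⟨
    1# * f (ν * y)                  ≈⟨ *-congʳ (inverseʳ μ μ≉0) ⟨
    (μ * μ ⁻¹) * f (ν * y)          ≈⟨ *-assoc _ _ _ ⟩
    μ * (μ ⁻¹ * f (ν * y))          ≈⟨ *-congˡ (*-congˡ (f-cong (*-assoc _ _ _))) ⟩
    μ * (μ ⁻¹ * f (μ * x))          ≈⟨ *-congˡ (g≈f[μ] x) ⟨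
    μ * g x                         ≈⟨ *-congˡ (g≈f[λ′] x) ⟩
    μ * (λ′ ⁻¹ * f (λ′ * x))        ≈⟨ *-congˡ (*-congˡ (f-cong λ′*x≈y)) ⟩
    μ * (λ′ ⁻¹ * f y)               ≈⟨ *-assoc _ _ _ ⟨
    ν * f y                         ∎
    where
    ν = μ * λ′ ⁻¹
    x = λ′ ⁻¹ * y
    λ′*x≈y : λ′ * x ≈ y
    λ′*x≈y = trans (sym (*-assoc _ _ _)) (trans (*-congʳ (inverseʳ λ′ λ′≉0)) (*-identityˡ y))

  x-y≈0⇒x≈y : ∀ {x y} → x - y ≈ 0# → x ≈ y
  x-y≈0⇒x≈y = x∙y⁻¹≈ε⇒x≈y _ _

  +-cancelˡ : ∀ {x y z} → x + y ≈ x + z → y ≈ z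
  +-cancelˡ = ∙-cancelˡ _ _ _

  -- Sums over an initial segment of ℕ; unlike sumF they can be reindexed by arithmetic.

  sumℕ : ℕ → (ℕ → Carrier) → Carrier
  sumℕ zero    g = 0#
  sumℕ (suc k) g = g 0 + sumℕ k (g ∘ suc)

  sumℕ-cong : ∀ k {g h : ℕ → Carrier} → (∀ m → g m ≈ h m) → sumℕ k g ≈ sumℕ k h
  sumℕ-cong zero    g≈h = refl
  sumℕ-cong (suc k) g≈h = +-cong (g≈h 0) (sumℕ-cong k (g≈h ∘ suc))

  sumℕ-zero : ∀ k {g : ℕ → Carrier} → (∀ m → m < k → g m ≈ 0#) → sumℕ k g ≈ 0#
  sumℕ-zero zero    g≈0 = refl
  sumℕ-zero (suc k) g≈0 =
    trans (+-cong (g≈0 0 (s≤s z≤n)) (sumℕ-zero k (λ m m<k → g≈0 (suc m) (s≤s m<k)))) (+-identityˡ 0#)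

  sumℕ-distrib-+ : ∀ k (g h : ℕ → Carrier) → sumℕ k (λ m → g m + h m) ≈ sumℕ k g + sumℕ k h
  sumℕ-distrib-+ zero    g h = sym (+-identityˡ 0#)
  sumℕ-distrib-+ (suc k) g h = begin
    (g 0 + h 0) + sumℕ k (λ m → g (suc m) + h (suc m))    ≈⟨ +-congˡ (sumℕ-distrib-+ k (g ∘ suc) (h ∘ suc)) ⟩
    (g 0 + h 0) + (sumℕ k (g ∘ suc) + sumℕ k (h ∘ suc))   ≈⟨ +-Solver.solve 4 (λ a b c d → (a ⊕ b) ⊕ (c ⊕ d) ⊜ (a ⊕ c) ⊕ (b ⊕ d)) refl (g 0) (h 0) _ _ ⟩
    (g 0 + sumℕ k (g ∘ suc)) + (h 0 + sumℕ k (h ∘ suc))   ∎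
    where
    import Algebra.Solver.CommutativeMonoid +-commutativeMonoid as +-Solver
    open +-Solver using (_⊕_; _⊜_)

  sumℕ-neg : ∀ k (g : ℕ → Carrier) → sumℕ k (λ m → - g m) ≈ - sumℕ k g
  sumℕ-neg zero    g = sym ε⁻¹≈ε
    where open import Algebra.Properties.Group +-group using (ε⁻¹≈ε)
  sumℕ-neg (suc k) g = trans (+-congˡ (sumℕ-neg k (g ∘ suc))) (⁻¹-∙-comm _ _)
    where open import Algebra.Properties.AbelianGroup +-abelianGroup using (⁻¹-∙-comm)

  *-distribˡ-sumℕ : ∀ k x (g : ℕ → Carrier) → x * sumℕ k g ≈ sumℕ k (λ m → x * g m)
  *-distribˡ-sumℕ zero    x g = zeroʳ x
  *-distribˡ-sumℕ (suc k) x g = trans (distribˡ x _ _) (+-congˡ (*-distribˡ-sumℕ k x (g ∘ suc)))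

  sumℕ-init-last : ∀ k (g : ℕ → Carrier) → sumℕ (suc k) g ≈ sumℕ k g + g k
  sumℕ-init-last zero    g = trans (+-identityʳ _) (sym (+-identityˡ _))
  sumℕ-init-last (suc k) g = trans (+-congˡ (sumℕ-init-last k (g ∘ suc))) (sym (+-assoc _ _ _))

  sumℕ-rotate : ∀ k (g : ℕ → Carrier) → g k ≈ g 0 → sumℕ k (g ∘ suc) ≈ sumℕ k g
  sumℕ-rotate k g gk≈g0 = +-cancelˡ (begin
    g 0 + sumℕ k (g ∘ suc) ≈⟨ sumℕ-init-last k g ⟩
    sumℕ k g + g k         ≈⟨ +-congˡ gk≈g0 ⟩
    sumℕ k g + g 0         ≈⟨ +-comm _ _ ⟩
    g 0 + sumℕ k g         ∎)

  sumℕ-shift : ∀ k t (g : ℕ → Carrier) → (∀ m → g (m Nat.+ k) ≈ g m) → sumℕ k (λ m → g (t Nat.+ m)) ≈ sumℕ k g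
  sumℕ-shift k zero    g periodic = refl
  sumℕ-shift k (suc t) g periodic = begin
    sumℕ k (λ m → g (suc t Nat.+ m)) ≈⟨ sumℕ-cong k (λ m → reflexive (≡.cong g (≡.sym (ℕP.+-suc t m)))) ⟩
    sumℕ k (λ m → g (t Nat.+ suc m)) ≈⟨ sumℕ-rotate k (λ m → g (t Nat.+ m)) (trans (periodic t) (reflexive (≡.cong g (≡.sym (ℕP.+-identityʳ t))))) ⟩
    sumℕ k (λ m → g (t Nat.+ m))     ≈⟨ sumℕ-shift k t g periodic ⟩
    sumℕ k g                         ∎

  sumℕ-pairs : ∀ r (h : ℕ → Carrier) → sumℕ (double r) h ≈ sumℕ r (λ j → h (double j) + h (suc (double j)))
  sumℕ-pairs zero    h = refl
  sumℕ-pairs (suc r) h = trans (sym (+-assoc _ _ _)) (+-congˡ (sumℕ-pairs r (h ∘ suc ∘ suc)))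

  sumF≈sumℕ : ∀ k (f : Fin k → Carrier) (g : ℕ → Carrier) → (∀ i → f i ≈ g (toℕ i)) → sumF F f ≈ sumℕ k g
  sumF≈sumℕ zero    f g f≈g = refl
  sumF≈sumℕ (suc k) f g f≈g = +-cong (f≈g Fin.zero) (sumF≈sumℕ k (f ∘ Fin.suc) (g ∘ suc) (f≈g ∘ Fin.suc))

  sumF-singleton : ∀ k (f : Fin k → Carrier) (i : Fin k) → (∀ j → j ≢ i → f j ≈ 0#) → sumF F f ≈ f i
  sumF-singleton (suc k) f Fin.zero f≈0 =
    trans (+-congˡ (trans (sum-cong-≋ {k} (λ j → f≈0 (Fin.suc j) (λ ()))) (sum-replicate-zero k))) (+-identityʳ _)
  sumF-singleton (suc k) f (Fin.suc i) f≈0 =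
    trans (+-congʳ (f≈0 Fin.zero (λ ())))
          (trans (+-identityˡ _) (sumF-singleton k (f ∘ Fin.suc) i (λ j j≢i → f≈0 (Fin.suc j) (j≢i ∘ FinP.suc-injective))))

-- Polynomials as coefficient lists, lowest degree first

module Polynomial {c ℓ} (F : Field c ℓ) where
  open Field F
  open FieldProperties F
  open import Relation.Binary.Reasoning.Setoid setoid
  import Algebra.Solver.CommutativeMonoid *-commutativeMonoid as *-Solver
  open *-Solver using (_⊕_; _⊜_)

  horner : List Carrier → Carrier → Carrier
  horner []       x = 0#
  horner (a ∷ as) x = a + x * horner as x

  IsZero : Carrier → Set ℓ
  IsZero x = x ≈ 0#

  horner-allZero : ∀ as x → All IsZero as → horner as x ≈ 0#
  horner-allZero []       x []          = refl
  horner-allZero (a ∷ as) x (a≈0 ∷ as≈0) =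
    trans (+-cong a≈0 (trans (*-congˡ (horner-allZero as x as≈0)) (zeroʳ x))) (+-identityˡ 0#)

  -- The quotient of the division by X - r.
  divLinear : Carrier → List Carrier → List Carrier
  divLinear r []            = []
  divLinear r (a ∷ [])      = []
  divLinear r (a ∷ a′ ∷ as) = horner (a′ ∷ as) r ∷ divLinear r (a′ ∷ as)

  length-divLinear : ∀ r a as → length (divLinear r (a ∷ as)) ≡ length as
  length-divLinear r a []        = ≡.refl
  length-divLinear r a (a′ ∷ as) = ≡.cong suc (length-divLinear r a′ as)

  horner-divLinear : ∀ r as x → horner as x ≈ horner as r + (x - r) * horner (divLinear r as) x
  horner-divLinear r []            x = sym (trans (+-identityˡ _) (zeroʳ _))
  horner-divLinear r (a ∷ [])      x =
    trans (+-congˡ (zeroʳ x)) (trans (sym (+-congˡ (zeroʳ r))) (sym (trans (+-congˡ (zeroʳ _)) (+-identityʳ _))))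
  horner-divLinear r (a ∷ a′ ∷ as) x = begin
    a + x * h x                                           ≈⟨ +-congˡ (*-congˡ (horner-divLinear r (a′ ∷ as) x)) ⟩
    a + x * (h r + d * h′ x)                              ≈⟨ +-congˡ (distribˡ x (h r) (d * h′ x)) ⟩
    a + (x * h r + x * (d * h′ x))                        ≈⟨ +-congˡ (+-cong (*-congʳ (sym r+d≈x)) x*[d*h′]≈d*[x*h′]) ⟩
    a + ((r + d) * h r + d * (x * h′ x))                  ≈⟨ +-congˡ (+-congʳ (distribʳ (h r) r d)) ⟩
    a + ((r * h r + d * h r) + d * (x * h′ x))            ≈⟨ +-congˡ (+-assoc _ _ _) ⟩
    a + (r * h r + (d * h r + d * (x * h′ x)))            ≈⟨ +-assoc _ _ _ ⟨
    (a + r * h r) + (d * h r + d * (x * h′ x))            ≈⟨ +-congˡ (distribˡ d (h r) (x * h′ x)) ⟨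
    (a + r * h r) + d * (h r + x * h′ x)                  ∎
    where
    d = x - r
    h = horner (a′ ∷ as)
    h′ = horner (divLinear r (a′ ∷ as))
    r+d≈x : r + d ≈ x
    r+d≈x = trans (+-congˡ (+-comm x (- r))) (trans (sym (+-assoc _ _ _)) (trans (+-congʳ (-‿inverseʳ r)) (+-identityˡ x)))
    x*[d*h′]≈d*[x*h′] : x * (d * h′ x) ≈ d * (x * h′ x)
    x*[d*h′]≈d*[x*h′] = *-Solver.solve 3 (λ u v w → u ⊕ (v ⊕ w) ⊜ v ⊕ (u ⊕ w)) refl x d (h′ x)

  divLinear-allZero⇒allZero : ∀ r a as → All IsZero (divLinear r (a ∷ as)) → All IsZero as
  divLinear-allZero⇒allZero r a []        _              = []
  divLinear-allZero⇒allZero r a (a′ ∷ as) (h≈0 ∷ quot≈0) = a′≈0 ∷ as≈0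
    where
    as≈0 = divLinear-allZero⇒allZero r a′ as quot≈0
    a′≈0 : a′ ≈ 0#
    a′≈0 = trans (sym (+-identityʳ a′)) (trans (+-congˡ (sym (trans (*-congˡ (horner-allZero as r as≈0)) (zeroʳ r)))) h≈0)

  roots⇒allZero : ∀ L as → length as ≡ L → (root : Fin L → Carrier) → (∀ i j → root i ≈ root j → i ≡ j) →
                  (∀ i → horner as (root i) ≈ 0#) → All IsZero as
  roots⇒allZero L       []       _       root root-inj vanish = []
  roots⇒allZero (suc L) (a ∷ as) ∣as∣≡L root root-inj vanish = a≈0 ∷ as≈0
    where
    r = root Fin.zero
    Q = divLinear r (a ∷ as)
    Q-vanish : ∀ i → horner Q (root (Fin.suc i)) ≈ 0#
    Q-vanish i = x*y≈0⇒y≈0 y-r≉0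
      (+-cancelˡ (trans (sym (horner-divLinear r (a ∷ as) y))
                        (trans (vanish (Fin.suc i)) (trans (sym (vanish Fin.zero)) (sym (+-identityʳ _))))))
      where
      y = root (Fin.suc i)
      y-r≉0 : y - r ≉ 0#
      y-r≉0 y-r≈0 with root-inj (Fin.suc i) Fin.zero (x-y≈0⇒x≈y y-r≈0)
      ... | ()
    as≈0 : All IsZero as
    as≈0 = divLinear-allZero⇒allZero r a as
      (roots⇒allZero L Q (≡.trans (length-divLinear r a as) (ℕP.suc-injective ∣as∣≡L))
        (root ∘ Fin.suc) (λ i j eq → FinP.suc-injective (root-inj (Fin.suc i) (Fin.suc j) eq)) Q-vanish)
    a≈0 : a ≈ 0#
    a≈0 = trans (sym (+-identityʳ a)) (trans (+-congˡ (sym (trans (*-congˡ (horner-allZero as r as≈0)) (zeroʳ r)))) (vanish Fin.zero))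

  horner-replicate-0 : ∀ g as x → horner (replicate g 0# ++ as) x ≈ x ^ g * horner as x
  horner-replicate-0 zero    as x = sym (*-identityˡ _)
  horner-replicate-0 (suc g) as x = begin
    0# + x * horner (replicate g 0# ++ as) x ≈⟨ +-identityˡ _ ⟩
    x * horner (replicate g 0# ++ as) x      ≈⟨ *-congˡ (horner-replicate-0 g as x) ⟩
    x * (x ^ g * horner as x)                ≈⟨ *-assoc _ _ _ ⟨
    (x * x ^ g) * horner as x                ∎

  -- The coefficient list of the sparse polynomial  Σ_m coeff m X^(E m)  with E strictly increasing.
  module Sparse (coeff : ℕ → Carrier) (E : ℕ → ℕ) (E-mono : ∀ m → E m < E (suc m)) where

    gap : ℕ → ℕ
    gap j = E (suc j) Nat.∸ suc (E j)

    gap-eq : ∀ j → suc (E j) Nat.+ gap j ≡ E (suc j)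
    gap-eq j = ℕP.m+[n∸m]≡n (E-mono j)

    -- the coefficients of  X^(-E j) Σ_{j ≤ m ≤ j+t} coeff m X^(E m)
    window : ℕ → ℕ → List Carrier
    window zero    j = coeff j ∷ []
    window (suc t) j = coeff j ∷ (replicate (gap j) 0# ++ window t (suc j))

    coeffs : ℕ → List Carrier
    coeffs t = replicate (E 0) 0# ++ window t 0

    horner-window : ∀ t j x → x ^ E j * horner (window t j) x ≈ sumℕ (suc t) (λ m → coeff (j Nat.+ m) * x ^ E (j Nat.+ m))
    horner-window zero j x = begin
      x ^ E j * (coeff j + x * 0#)                    ≈⟨ *-congˡ (trans (+-congˡ (zeroʳ x)) (+-identityʳ _)) ⟩
      x ^ E j * coeff j                               ≈⟨ *-comm _ _ ⟩
      coeff j * x ^ E j                               ≈⟨ term-j+0 ⟨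
      coeff (j Nat.+ 0) * x ^ E (j Nat.+ 0)           ≈⟨ +-identityʳ _ ⟨
      coeff (j Nat.+ 0) * x ^ E (j Nat.+ 0) + 0#      ∎
      where term-j+0 = reflexive (≡.cong (λ u → coeff u * x ^ E u) (ℕP.+-identityʳ j))
    horner-window (suc t) j x = begin
      x ^ E j * (coeff j + x * horner (replicate (gap j) 0# ++ W) x)              ≈⟨ distribˡ _ _ _ ⟩
      x ^ E j * coeff j + x ^ E j * (x * horner (replicate (gap j) 0# ++ W) x)    ≈⟨ +-cong (*-comm _ _) (*-congˡ (*-congˡ (horner-replicate-0 (gap j) W x))) ⟩
      coeff j * x ^ E j + x ^ E j * (x * (x ^ gap j * horner W x))                ≈⟨ +-cong term-j+0 powers ⟩
      coeff (j Nat.+ 0) * x ^ E (j Nat.+ 0) + x ^ E (suc j) * horner W x          ≈⟨ +-congˡ (horner-window t (suc j) x) ⟩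
      coeff (j Nat.+ 0) * x ^ E (j Nat.+ 0) + sumℕ (suc t) (λ m → coeff (suc j Nat.+ m) * x ^ E (suc j Nat.+ m))
        ≈⟨ +-congˡ (sumℕ-cong (suc t) (λ m → reflexive (≡.cong (λ u → coeff u * x ^ E u) (≡.sym (ℕP.+-suc j m))))) ⟩
      coeff (j Nat.+ 0) * x ^ E (j Nat.+ 0) + sumℕ (suc t) (λ m → coeff (j Nat.+ suc m) * x ^ E (j Nat.+ suc m)) ∎
      where
      W = window t (suc j)
      term-j+0 = reflexive (≡.cong (λ u → coeff u * x ^ E u) (≡.sym (ℕP.+-identityʳ j)))
      powers : x ^ E j * (x * (x ^ gap j * horner W x)) ≈ x ^ E (suc j) * horner W x
      powers = begin
        x ^ E j * (x * (x ^ gap j * horner W x)) ≈⟨ *-Solver.solve 4 (λ a b u v → a ⊕ (b ⊕ (u ⊕ v)) ⊜ ((b ⊕ a) ⊕ u) ⊕ v) refl (x ^ E j) x (x ^ gap j) (horner W x) ⟩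
        ((x * x ^ E j) * x ^ gap j) * horner W x ≈⟨ *-congʳ (^-homo-* x (suc (E j)) (gap j)) ⟨
        x ^ (suc (E j) Nat.+ gap j) * horner W x ≈⟨ *-congʳ (^-congʳ x (gap-eq j)) ⟩
        x ^ E (suc j) * horner W x               ∎

    horner-coeffs : ∀ t x → horner (coeffs t) x ≈ sumℕ (suc t) (λ m → coeff m * x ^ E m)
    horner-coeffs t x = trans (horner-replicate-0 (E 0) (window t 0) x) (horner-window t 0 x)

    length-window : ∀ t j → E j Nat.+ length (window t j) ≤ suc (E (j Nat.+ t))
    length-window zero    j = ℕP.≤-reflexive (≡.trans (ℕP.+-comm (E j) 1) (≡.cong (λ u → suc (E u)) (≡.sym (ℕP.+-identityʳ j))))
    length-window (suc t) j = ℕP.≤-trans (ℕP.≤-reflexive eq)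
      (ℕP.≤-trans (length-window t (suc j)) (ℕP.≤-reflexive (≡.cong (λ u → suc (E u)) (≡.sym (ℕP.+-suc j t)))))
      where
      W = window t (suc j)
      ∣0s++W∣ : length (replicate (gap j) 0# ++ W) ≡ gap j Nat.+ length W
      ∣0s++W∣ = ≡.trans (ListP.length-++ (replicate (gap j) 0#)) (≡.cong (Nat._+ length W) (ListP.length-replicate (gap j)))
      eq : E j Nat.+ suc (length (replicate (gap j) 0# ++ W)) ≡ E (suc j) Nat.+ length W
      eq = ≡.trans (ℕP.+-suc (E j) _)
             (≡.trans (≡.cong (λ u → suc (E j Nat.+ u)) ∣0s++W∣)
               (≡.trans (≡.sym (ℕP.+-assoc (suc (E j)) (gap j) _)) (≡.cong (Nat._+ length W) (gap-eq j))))

    length-coeffs : ∀ t → length (coeffs t) ≤ E (suc t)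
    length-coeffs t = ℕP.≤-trans
      (ℕP.≤-reflexive (≡.trans (ListP.length-++ (replicate (E 0) 0#)) (≡.cong (Nat._+ length (window t 0)) (ListP.length-replicate (E 0)))))
      (ℕP.≤-trans (length-window t 0) (E-mono t))

    window-allZero : ∀ t j m → m ≤ t → All IsZero (window t j) → coeff (j Nat.+ m) ≈ 0#
    window-allZero zero    j zero    _         (c≈0 ∷ _) = trans (reflexive (≡.cong coeff (ℕP.+-identityʳ j))) c≈0
    window-allZero (suc t) j zero    _         (c≈0 ∷ _) = trans (reflexive (≡.cong coeff (ℕP.+-identityʳ j))) c≈0
    window-allZero (suc t) j (suc m) (s≤s m≤t) (_ ∷ rest) =
      trans (reflexive (≡.cong coeff (ℕP.+-suc j m))) (window-allZero t (suc j) m m≤t (++⁻ʳ (replicate (gap j) 0#) rest))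

    coeffs-allZero : ∀ t m → m ≤ t → All IsZero (coeffs t) → coeff m ≈ 0#
    coeffs-allZero t m m≤t as≈0 = window-allZero t 0 m m≤t (++⁻ʳ (replicate (E 0) 0#) as≈0)

module FiniteField {c ℓ} (F : Field c ℓ) {N : ℕ} (card : HasCardinality F N) where
  open Field F
  open FieldProperties F
  open Polynomial F
  open import Relation.Binary.Reasoning.Setoid setoid
  open Inverse card using (to; from; from-cong; strictlyInverseˡ; strictlyInverseʳ)
  open RawMonoid +-rawMonoid using () renaming (_×_ to _·_)

  infix 4 _≟_
  _≟_ : ∀ x y → Dec (x ≈ y)
  x ≟ y with from x Fin.≟ from y
  ... | yes fx≡fy = yes (trans (sym (strictlyInverseˡ x)) (trans (reflexive (≡.cong to fx≡fy)) (strictlyInverseˡ y)))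
  ... | no  fx≢fy = no (fx≢fy ∘ from-cong)

  ≈-stable : ∀ {x y} → ¬ ¬ (x ≈ y) → x ≈ y
  ≈-stable = Dec.decidable-stable (_ ≟ _)

  ∃≉0 : (h : Carrier → Carrier) → (∀ {x y} → x ≈ y → h x ≈ h y) → ¬ (∀ y → h y ≈ 0#) → Σ Carrier (λ y → h y ≉ 0#)
  ∃≉0 h h-cong h≉0 with FinP.any? (λ i → Dec.¬? (h (to i) ≟ 0#))
  ... | yes (i , hi≉0) = to i , hi≉0
  ... | no  ∄i         = ⊥-elim (h≉0 (λ y → ≈-stable (λ hy≉0 → ∄i (from y , λ hi≈0 → hy≉0 (trans (h-cong (sym (strictlyInverseˡ y))) hi≈0)))))

  inducedPermutation : (h h⁻ : Carrier → Carrier) →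
                       (∀ {x y} → x ≈ y → h x ≈ h y) → (∀ {x y} → x ≈ y → h⁻ x ≈ h⁻ y) →
                       (∀ y → h (h⁻ y) ≈ y) → (∀ y → h⁻ (h y) ≈ y) → Permutation N N
  inducedPermutation h h⁻ h-cong h⁻-cong h∘h⁻ h⁻∘h =
    permutation (λ i → from (h (to i))) (λ i → from (h⁻ (to i))) (inverse h h⁻ h-cong h∘h⁻) (inverse h⁻ h h⁻-cong h⁻∘h)
    where
    inverse : ∀ g g⁻ → (∀ {x y} → x ≈ y → g x ≈ g y) → (∀ y → g (g⁻ y) ≈ y) → ∀ i → from (g (to (from (g⁻ (to i))))) ≡ i
    inverse g g⁻ g-cong g∘g⁻ i = ≡.trans (from-cong (trans (g-cong (strictlyInverseˡ _)) (g∘g⁻ (to i)))) (strictlyInverseʳ i)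

  translation : Carrier → Permutation N N
  translation x = inducedPermutation (x +_) (- x +_) +-congˡ +-congˡ
    (λ y → trans (sym (+-assoc _ _ _)) (trans (+-congʳ (-‿inverseʳ x)) (+-identityˡ y)))
    (λ y → trans (sym (+-assoc _ _ _)) (trans (+-congʳ (-‿inverseˡ x)) (+-identityˡ y)))

  dilation : ∀ x → x ≉ 0# → Permutation N N
  dilation x x≉0 = inducedPermutation (x *_) (x ⁻¹ *_) *-congˡ *-congˡ
    (λ y → trans (sym (*-assoc _ _ _)) (trans (*-congʳ (inverseʳ x x≉0)) (*-identityˡ y)))
    (λ y → trans (sym (*-assoc _ _ _)) (trans (*-congʳ (inverseˡ x x≉0)) (*-identityˡ y)))

  -- Translating by x permutes the elements, so their sum absorbs N · x.
  N·x≈0 : ∀ x → N · x ≈ 0#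
  N·x≈0 x = +-cancelˡ (begin
    sumF F to + N · x                  ≈⟨ +-comm _ _ ⟩
    N · x + sumF F to                  ≈⟨ +-congʳ (sum-replicate N) ⟨
    sumF F {N} (λ _ → x) + sumF F to   ≈⟨ ∑-distrib-+ (λ _ → x) to ⟨
    sumF F (λ i → x + to i)            ≈⟨ sum-cong-≋ {N} (λ i → strictlyInverseˡ _) ⟨
    sumF F (λ i → to (from (x + to i))) ≈⟨ sum-permute to (translation x) ⟨
    sumF F to                          ≈⟨ +-identityʳ _ ⟨
    sumF F to + 0#                     ∎)
    where open import Algebra.Properties.CommutativeMonoid.Sum +-commutativeMonoid

  -- Fermat: dilating by x ≉ 0 permutes the elements; the product of all of them,
  -- with 0 counted as 1, then picks up the factor x^N / x.
  module _ where
    open import Algebra.Properties.CommutativeMonoid.Sum *-commutativeMonoid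
      using (sum-permute; ∑-distrib-+; sum-cong-≋)
      renaming (sum to prod)

    prod-≉0 : ∀ k (f : Fin k → Carrier) → (∀ i → f i ≉ 0#) → prod f ≉ 0#
    prod-≉0 zero    f f≉0 = 1≉0
    prod-≉0 (suc k) f f≉0 = *-≉0 (f≉0 Fin.zero) (prod-≉0 k (f ∘ Fin.suc) (f≉0 ∘ Fin.suc))

    prod-const : ∀ k x → prod {k} (λ _ → x) ≈ x ^ k
    prod-const zero    x = refl
    prod-const (suc k) x = *-congˡ (prod-const k x)

    prod-except : ∀ k (f g : Fin k → Carrier) (i₀ : Fin k) x → (∀ j → j ≢ i₀ → g j ≈ f j) → g i₀ ≈ f i₀ * x →
                  prod g ≈ prod f * x
    prod-except (suc k) f g Fin.zero x g≈f gi₀≈fi₀*x = begin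
      g Fin.zero * prod (g ∘ Fin.suc)         ≈⟨ *-cong gi₀≈fi₀*x (sum-cong-≋ (λ j → g≈f (Fin.suc j) (λ ()))) ⟩
      (f Fin.zero * x) * prod (f ∘ Fin.suc)   ≈⟨ *-Solver.solve 3 (λ a b c → (a ⊕ b) ⊕ c ⊜ (a ⊕ c) ⊕ b) refl _ _ _ ⟩
      (f Fin.zero * prod (f ∘ Fin.suc)) * x   ∎
      where
      import Algebra.Solver.CommutativeMonoid *-commutativeMonoid as *-Solver
      open *-Solver using (_⊕_; _⊜_)
    prod-except (suc k) f g (Fin.suc i) x g≈f gi₀≈fi₀*x = begin
      g Fin.zero * prod (g ∘ Fin.suc)         ≈⟨ *-cong (g≈f Fin.zero (λ ())) (prod-except k (f ∘ Fin.suc) (g ∘ Fin.suc) i x (λ j j≢i → g≈f (Fin.suc j) (j≢i ∘ FinP.suc-injective)) gi₀≈fi₀*x) ⟩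
      f Fin.zero * (prod (f ∘ Fin.suc) * x)   ≈⟨ *-assoc _ _ _ ⟨
      (f Fin.zero * prod (f ∘ Fin.suc)) * x   ∎

    nonzeroOr1 : Carrier → Carrier
    nonzeroOr1 z with z ≟ 0#
    ... | yes _ = 1#
    ... | no  _ = z

    nonzeroOr1-≉0 : ∀ z → nonzeroOr1 z ≉ 0#
    nonzeroOr1-≉0 z with z ≟ 0#
    ... | yes _   = 1≉0
    ... | no z≉0 = z≉0

    nonzeroOr1-0 : ∀ {z} → z ≈ 0# → nonzeroOr1 z ≈ 1#
    nonzeroOr1-0 {z} z≈0 with z ≟ 0#
    ... | yes _   = refl
    ... | no z≉0 = ⊥-elim (z≉0 z≈0)

    nonzeroOr1-≉ : ∀ {z} → z ≉ 0# → nonzeroOr1 z ≈ z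
    nonzeroOr1-≉ {z} z≉0 with z ≟ 0#
    ... | yes z≈0 = ⊥-elim (z≉0 z≈0)
    ... | no  _   = refl

    nonzeroOr1-cong : ∀ {z z′} → z ≈ z′ → nonzeroOr1 z ≈ nonzeroOr1 z′
    nonzeroOr1-cong {z} {z′} z≈z′ with z ≟ 0#
    ... | yes z≈0 = sym (nonzeroOr1-0 (trans (sym z≈z′) z≈0))
    ... | no  z≉0 = trans z≈z′ (sym (nonzeroOr1-≉ (z≉0 ∘ trans z≈z′)))

    x^N≈x : ∀ x → x ^ N ≈ x
    x^N≈x x with x ≟ 0#
    ... | yes x≈0 = trans (^-congˡ N x≈0) (trans (0^m≈0 N ⦃ FinP.nonZeroIndex (from 0#) ⦄) (sym x≈0))
    ... | no  x≉0 = sym (*-cancelˡ P≉0 (begin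
      P * x                  ≈⟨ *-congʳ P≈prod[x*] ⟩
      prod f * x             ≈⟨ prod-except N f g i₀ x g≈f gi₀≈fi₀*x ⟨
      prod g                 ≈⟨ ∑-distrib-+ (λ _ → x) (nonzeroOr1 ∘ to) ⟩
      prod {N} (λ _ → x) * P ≈⟨ *-congʳ (prod-const N x) ⟩
      x ^ N * P              ≈⟨ *-comm _ _ ⟩
      P * x ^ N              ∎))
      where
      P = prod (nonzeroOr1 ∘ to)
      P≉0 : P ≉ 0#
      P≉0 = prod-≉0 N (nonzeroOr1 ∘ to) (nonzeroOr1-≉0 ∘ to)
      f g : Fin N → Carrier
      f i = nonzeroOr1 (x * to i)
      g i = x * nonzeroOr1 (to i)
      i₀ = from 0#
      P≈prod[x*] : P ≈ prod f
      P≈prod[x*] = trans (sum-permute (nonzeroOr1 ∘ to) (dilation x x≉0)) (sum-cong-≋ {N} (λ i → nonzeroOr1-cong (strictlyInverseˡ _)))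
      g≈f : ∀ j → j ≢ i₀ → g j ≈ f j
      g≈f j j≢i₀ = trans (*-congˡ (nonzeroOr1-≉ tj≉0)) (sym (nonzeroOr1-≉ (*-≉0 x≉0 tj≉0)))
        where
        tj≉0 : to j ≉ 0#
        tj≉0 tj≈0 = j≢i₀ (≡.trans (≡.sym (strictlyInverseʳ j)) (from-cong tj≈0))
      ti₀≈0 : to i₀ ≈ 0#
      ti₀≈0 = strictlyInverseˡ 0#
      gi₀≈fi₀*x : g i₀ ≈ f i₀ * x
      gi₀≈fi₀*x = begin
        x * nonzeroOr1 (to i₀) ≈⟨ *-congˡ (nonzeroOr1-0 ti₀≈0) ⟩
        x * 1#                 ≈⟨ *-comm _ _ ⟩
        1# * x                 ≈⟨ *-congʳ (nonzeroOr1-0 (trans (*-congˡ ti₀≈0) (zeroʳ x))) ⟨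
        f i₀ * x               ∎

  sparse-vanishing⇒coeff≈0 : (coeff : ℕ → Carrier) (E : ℕ → ℕ) → (∀ m → E m < E (suc m)) → (M : ℕ) → E M ≤ N →
                             (∀ y → sumℕ M (λ m → coeff m * y ^ E m) ≈ 0#) → ∀ m → m < M → coeff m ≈ 0#
  sparse-vanishing⇒coeff≈0 coeff E E-mono (suc t) E[M]≤N vanish m (s≤s m≤t) = coeffs-allZero t m m≤t coeffs≈0
    where
    open Sparse coeff E E-mono
    ∣coeffs∣≤N : length (coeffs t) ≤ N
    ∣coeffs∣≤N = ℕP.≤-trans (length-coeffs t) E[M]≤N
    root : Fin (length (coeffs t)) → Carrier
    root i = to (Fin.inject≤ i ∣coeffs∣≤N)
    root-inj : ∀ i j → root i ≈ root j → i ≡ j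
    root-inj i j ri≈rj = FinP.inject≤-injective ∣coeffs∣≤N ∣coeffs∣≤N i j
      (≡.trans (≡.sym (strictlyInverseʳ _)) (≡.trans (from-cong ri≈rj) (strictlyInverseʳ _)))
    coeffs≈0 : All IsZero (coeffs t)
    coeffs≈0 = roots⇒allZero (length (coeffs t)) (coeffs t) ≡.refl root root-inj (λ i → trans (horner-coeffs t (root i)) (vanish (root i)))

module PrimePowerField {c ℓ} (F : Field c ℓ) {p M : ℕ} (p-prime : Prime p) (card : HasCardinality F (p Nat.^ M)) where
  open Field F
  open FieldProperties F
  open FiniteField F card using (N·x≈0; ≈-stable)
  open import Relation.Binary.Reasoning.Setoid setoid
  open RawMonoid +-rawMonoid using () renaming (_×_ to _·_)
  import Algebra.Properties.Semiring.Mult semiring as ·-Properties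
  import Algebra.Properties.Monoid.Mult +-monoid as ·-MonoidProperties
  open import Algebra.Properties.Semiring.Exp semiring using () renaming (_^_ to _^′_)
  import Algebra.Properties.CommutativeSemiring.Binomial commutativeSemiring as Binomial

  instance
    p≢0 : NonZero p
    p≢0 = prime⇒nonZero p-prime

  [p^m]·1≈[p·1]^m : ∀ m → (p Nat.^ m) · 1# ≈ (p · 1#) ^ m
  [p^m]·1≈[p·1]^m zero    = +-identityʳ 1#
  [p^m]·1≈[p·1]^m (suc m) = trans (·-Properties.×1-homo-* p (p Nat.^ m)) (*-congˡ ([p^m]·1≈[p·1]^m m))

  p·1≈0 : p · 1# ≈ 0#
  p·1≈0 = ≈-stable (λ p·1≉0 → ^-≉0 M p·1≉0 (trans (sym ([p^m]·1≈[p·1]^m M)) (N·x≈0 1#)))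

  p·x≈0 : ∀ x → p · x ≈ 0#
  p·x≈0 x = begin
    p · x          ≈⟨ ·-MonoidProperties.×-congʳ p (*-identityˡ x) ⟨
    p · (1# * x)   ≈⟨ ·-Properties.×-assoc-* p 1# x ⟨
    (p · 1#) * x   ≈⟨ *-congʳ p·1≈0 ⟩
    0# * x         ≈⟨ zeroˡ x ⟩
    0#             ∎

  [pCm]·x≈0 : ∀ {m} x → 0 < m → m < p → (p C m) · x ≈ 0#
  [pCm]·x≈0 {m} x 0<m m<p with p∣pCm p-prime 0<m m<p
  ... | divides t pCm≡t*p = begin
    (p C m) · x     ≡⟨ ≡.cong (_· x) (≡.trans pCm≡t*p (ℕP.*-comm t p)) ⟩
    (p Nat.* t) · x ≈⟨ ·-MonoidProperties.×-assocˡ x p t ⟨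
    p · (t · x)     ≈⟨ p·x≈0 (t · x) ⟩
    0#              ∎

  ^′≈^ : ∀ x m → x ^′ m ≈ x ^ m
  ^′≈^ x zero    = refl
  ^′≈^ x (suc m) = *-congˡ (^′≈^ x m)

  -- In the binomial expansion of (x + y)^p all middle terms vanish.
  freshman : ∀ x y → (x + y) ^ p ≈ x ^ p + y ^ p
  freshman x y = go (Nat.pred p) (≡.sym (ℕP.suc-pred p))
    where
    term : ℕ → Carrier
    term m = (p C m) · (x ^′ m * y ^′ (p Nat.∸ m))
    go : ∀ p′ → p ≡ suc p′ → (x + y) ^ p ≈ x ^ p + y ^ p
    go p′ p≡1+p′ = begin
      (x + y) ^ p                                 ≈⟨ ^′≈^ (x + y) p ⟨
      (x + y) ^′ p                                ≈⟨ Binomial.theorem p x y ⟩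
      Binomial.binomialExpansion x y p            ≈⟨ sumF≈sumℕ (suc p) _ term (λ i → refl) ⟩
      term 0 + sumℕ p (term ∘ suc)                ≡⟨ ≡.cong (λ r → term 0 + sumℕ r (term ∘ suc)) p≡1+p′ ⟩
      term 0 + sumℕ (suc p′) (term ∘ suc)         ≈⟨ +-congˡ (sumℕ-init-last p′ (term ∘ suc)) ⟩
      term 0 + (sumℕ p′ (term ∘ suc) + term (suc p′)) ≈⟨ +-congˡ (+-congʳ (sumℕ-zero p′ middle≈0)) ⟩
      term 0 + (0# + term (suc p′))               ≈⟨ +-cong term0≈y^p (trans (+-identityˡ _) term[p]≈x^p) ⟩
      y ^ p + x ^ p                               ≈⟨ +-comm _ _ ⟩
      x ^ p + y ^ p                               ∎
      where
      middle≈0 : ∀ m → m < p′ → term (suc m) ≈ 0#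
      middle≈0 m m<p′ = [pCm]·x≈0 _ (s≤s z≤n) (≡.subst (suc m <_) (≡.sym p≡1+p′) (s≤s m<p′))
      term0≈y^p : term 0 ≈ y ^ p
      term0≈y^p = trans (+-identityʳ _) (trans (*-identityˡ _) (^′≈^ y p))
      term[p]≈x^p : term (suc p′) ≈ x ^ p
      term[p]≈x^p = begin
        term (suc p′)                          ≡⟨ ≡.cong term (≡.sym p≡1+p′) ⟩
        (p C p) · (x ^′ p * y ^′ (p Nat.∸ p))  ≡⟨ ≡.cong (λ r → r · (x ^′ p * y ^′ (p Nat.∸ p))) (nCn≡1 p) ⟩
        1 · (x ^′ p * y ^′ (p Nat.∸ p))        ≈⟨ +-identityʳ _ ⟩
        x ^′ p * y ^′ (p Nat.∸ p)              ≡⟨ ≡.cong (λ r → x ^′ p * y ^′ r) (ℕP.n∸n≡0 p) ⟩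
        x ^′ p * 1#                            ≈⟨ *-identityʳ _ ⟩
        x ^′ p                                 ≈⟨ ^′≈^ x p ⟩
        x ^ p                                  ∎

  freshman-^ : ∀ t x y → (x + y) ^ (p Nat.^ t) ≈ x ^ (p Nat.^ t) + y ^ (p Nat.^ t)
  freshman-^ zero    x y = trans (x^1≈x _) (sym (+-cong (x^1≈x x) (x^1≈x y)))
  freshman-^ (suc t) x y = begin
    (x + y) ^ (p Nat.* p Nat.^ t)              ≈⟨ ^-*-assoc (x + y) p (p Nat.^ t) ⟨
    ((x + y) ^ p) ^ (p Nat.^ t)                ≈⟨ ^-congˡ (p Nat.^ t) (freshman x y) ⟩
    (x ^ p + y ^ p) ^ (p Nat.^ t)              ≈⟨ freshman-^ t _ _ ⟩
    (x ^ p) ^ (p Nat.^ t) + (y ^ p) ^ (p Nat.^ t) ≈⟨ +-cong (^-*-assoc x p (p Nat.^ t)) (^-*-assoc y p (p Nat.^ t)) ⟩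
    x ^ (p Nat.* p Nat.^ t) + y ^ (p Nat.* p Nat.^ t) ∎

-- The Frobenius automorphisms x ↦ x^(q^a) of F_(q^n)

module Frobenius {c ℓ} (F : Field c ℓ) {p k : ℕ} (n : ℕ) .{{_ : NonZero n}} (p-prime : Prime p) (1≤k : 1 ≤ k)
                 (card : HasCardinality F ((p Nat.^ k) Nat.^ n)) where
  open Field F
  open FieldProperties F
  open import Relation.Binary.Reasoning.Setoid setoid

  q : ℕ
  q = p Nat.^ k

  instance
    p≢0 : NonZero p
    p≢0 = prime⇒nonZero p-prime
    q≢0 : NonZero q
    q≢0 = ℕP.m^n≢0 p k

  card′ : HasCardinality F (p Nat.^ (k Nat.* n))
  card′ = ≡.subst (HasCardinality F) (ℕP.^-*-assoc p k n) card

  open FiniteField F card public using (_≟_; ≈-stable; ∃≉0; sparse-vanishing⇒coeff≈0)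
  open FiniteField F card′ using (x^N≈x)
  open PrimePowerField F {M = k Nat.* n} p-prime card′ using (freshman-^)

  1<q : 1 < q
  1<q = ℕP.<-≤-trans (Nat.nonTrivial⇒n>1 p ⦃ prime⇒nonTrivial p-prime ⦄)
                     (ℕP.≤-trans (ℕP.≤-reflexive (≡.sym (ℕP.*-identityʳ p))) (ℕP.^-monoʳ-≤ p 1≤k))

  q^-mono : ∀ {a b} → a < b → q Nat.^ a < q Nat.^ b
  q^-mono = ℕP.^-monoʳ-< q 1<q

  frob : ℕ → Carrier → Carrier
  frob a x = x ^ (q Nat.^ a)

  frob-cong : ∀ a {x y} → x ≈ y → frob a x ≈ frob a y
  frob-cong a = ^-congˡ (q Nat.^ a)

  frob-+ : ∀ a x y → frob a (x + y) ≈ frob a x + frob a y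
  frob-+ a x y = begin
    (x + y) ^ (q Nat.^ a)                           ≈⟨ ^-congʳ _ q^a≡p^ka ⟩
    (x + y) ^ (p Nat.^ (k Nat.* a))                 ≈⟨ freshman-^ (k Nat.* a) x y ⟩
    x ^ (p Nat.^ (k Nat.* a)) + y ^ (p Nat.^ (k Nat.* a)) ≈⟨ +-cong (^-congʳ x q^a≡p^ka) (^-congʳ y q^a≡p^ka) ⟨
    frob a x + frob a y                             ∎
    where q^a≡p^ka = ℕP.^-*-assoc p k a

  frob-* : ∀ a x y → frob a (x * y) ≈ frob a x * frob a y
  frob-* a x y = ^-distrib-* x y (q Nat.^ a)

  frob-0# : ∀ a → frob a 0# ≈ 0#
  frob-0# a = 0^m≈0 (q Nat.^ a) ⦃ ℕP.m^n≢0 q a ⦄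

  frob-sumℕ : ∀ a m g → frob a (sumℕ m g) ≈ sumℕ m (λ i → frob a (g i))
  frob-sumℕ a zero    g = frob-0# a
  frob-sumℕ a (suc m) g = trans (frob-+ a _ _) (+-congˡ (frob-sumℕ a m (g ∘ suc)))

  frob-∘ : ∀ a b x → frob a (frob b x) ≈ frob (b Nat.+ a) x
  frob-∘ a b x = trans (^-*-assoc x (q Nat.^ b) (q Nat.^ a)) (^-congʳ x (≡.sym (ℕP.^-distribˡ-+-* q b a)))

  frob-≉0 : ∀ a {x} → x ≉ 0# → frob a x ≉ 0#
  frob-≉0 a = ^-≉0 (q Nat.^ a)

  frob-0 : ∀ x → frob 0 x ≈ x
  frob-0 = x^1≈x

  frob-n : ∀ x → frob n x ≈ x
  frob-n x = trans (^-congʳ x (ℕP.^-*-assoc p k n)) (x^N≈x x)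

  frob-periodic : ∀ t a x → frob (t Nat.* n Nat.+ a) x ≈ frob a x
  frob-periodic zero    a x = refl
  frob-periodic (suc t) a x = begin
    frob (n Nat.+ t Nat.* n Nat.+ a) x   ≈⟨ ^-congʳ x (≡.cong (q Nat.^_) (ℕP.+-assoc n (t Nat.* n) a)) ⟩
    frob (n Nat.+ (t Nat.* n Nat.+ a)) x ≈⟨ frob-∘ _ n x ⟨
    frob (t Nat.* n Nat.+ a) (frob n x)  ≈⟨ frob-cong (t Nat.* n Nat.+ a) (frob-n x) ⟩
    frob (t Nat.* n Nat.+ a) x           ≈⟨ frob-periodic t a x ⟩
    frob a x                             ∎

  frob-% : ∀ a x → frob a x ≈ frob (a % n) x
  frob-% a x = trans (^-congʳ x (≡.cong (q Nat.^_) (≡.trans (ℕDM.m≡m%n+[m/n]*n a n) (ℕP.+-comm (a % n) _))))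
                     (frob-periodic (a / n) (a % n) x)

  frob-cong-% : ∀ a b x → a % n ≡ b % n → frob a x ≈ frob b x
  frob-cong-% a b x a≡b = trans (frob-% a x) (trans (^-congʳ x (≡.cong (q Nat.^_) a≡b)) (sym (frob-% b x)))

  -- The subfield F_(q^e) as the fixed points of frob e

  Fixed : ℕ → Carrier → Set ℓ
  Fixed e x = frob e x ≈ x

  Fixed-* : ∀ t e x → Fixed e x → Fixed (t Nat.* e) x
  Fixed-* zero    e x _      = frob-0 x
  Fixed-* (suc t) e x fixed = trans (sym (frob-∘ (t Nat.* e) e x)) (trans (frob-cong (t Nat.* e) fixed) (Fixed-* t e x fixed))

  Fixed-∸ : ∀ d e x → Fixed (d Nat.+ e) x → Fixed e x → Fixed d x
  Fixed-∸ d e x fixed[d+e] fixed[e] = begin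
    frob d x           ≈⟨ frob-cong d (sym fixed[e]) ⟩
    frob d (frob e x)  ≈⟨ frob-∘ d e x ⟩
    frob (e Nat.+ d) x ≈⟨ ^-congʳ x (≡.cong (q Nat.^_) (ℕP.+-comm e d)) ⟩
    frob (d Nat.+ e) x ≈⟨ fixed[d+e] ⟩
    x                  ∎

  Fixed-gcd : ∀ s t x → Fixed s x → Fixed t x → Fixed (gcd s t) x
  Fixed-gcd s t x fixed[s] fixed[t] with Bézout.identity (gcd-GCD s t)
  ... | Bézout.Identity.+- a b gcd+bt≡as =
    Fixed-∸ (gcd s t) (b Nat.* t) x (≡.subst (λ z → Fixed z x) (≡.sym gcd+bt≡as) (Fixed-* a s x fixed[s])) (Fixed-* b t x fixed[t])
  ... | Bézout.Identity.-+ a b gcd+as≡bt =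
    Fixed-∸ (gcd s t) (a Nat.* s) x (≡.subst (λ z → Fixed z x) (≡.sym gcd+as≡bt) (Fixed-* b t x fixed[t])) (Fixed-* a s x fixed[s])

  -- If e ∣ n and 0 < g < e then F_(q^e) ⊈ F_(q^g): otherwise the trace T from F_(q^n) onto
  -- F_(q^e) would make  y ↦ frob g (T y) - T y  a nonzero sparse polynomial of degree q^n
  -- vanishing on the whole field.
  Fixed-⊈ : ∀ {g e} → 1 ≤ g → g < e → e ∣ n → ¬ (∀ x → Fixed e x → Fixed g x)
  Fixed-⊈ {g} {e} 1≤g g<e (divides r n≡r*e) Fixed[e]⊆Fixed[g] = 1≉0 (trans (sym (+-identityʳ 1#)) (trans (+-congˡ (sym -1≈0)) (-‿inverseʳ 1#)))
    where
    open import Algebra.Properties.Ring ring using (-1*x≈-x)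

    sign : ℕ → Carrier
    sign zero          = - 1#
    sign (suc zero)    = 1#
    sign (suc (suc m)) = sign m

    sign-even : ∀ j → sign (double j) ≡ - 1#
    sign-even zero    = ≡.refl
    sign-even (suc j) = sign-even j

    sign-odd : ∀ j → sign (suc (double j)) ≡ 1#
    sign-odd zero    = ≡.refl
    sign-odd (suc j) = sign-odd j

    exponent : ℕ → ℕ
    exponent zero          = 0
    exponent (suc zero)    = g
    exponent (suc (suc m)) = e Nat.+ exponent m

    exponent-even : ∀ j → exponent (double j) ≡ j Nat.* e
    exponent-even zero    = ≡.refl
    exponent-even (suc j) = ≡.cong (e Nat.+_) (exponent-even j)

    exponent-odd : ∀ j → exponent (suc (double j)) ≡ j Nat.* e Nat.+ g
    exponent-odd zero    = ≡.refl
    exponent-odd (suc j) = ≡.trans (≡.cong (e Nat.+_) (exponent-odd j)) (≡.sym (ℕP.+-assoc e (j Nat.* e) g))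

    exponent-mono : ∀ m → exponent m < exponent (suc m)
    exponent-mono zero          = 1≤g
    exponent-mono (suc zero)    = ℕP.<-≤-trans g<e (ℕP.≤-reflexive (≡.sym (ℕP.+-identityʳ e)))
    exponent-mono (suc (suc m)) = ℕP.+-monoʳ-< e (exponent-mono m)

    T : Carrier → Carrier
    T y = sumℕ r (λ j → frob (j Nat.* e) y)

    T-Fixed : ∀ y → Fixed e (T y)
    T-Fixed y = begin
      frob e (T y)                              ≈⟨ frob-sumℕ e r (λ j → frob (j Nat.* e) y) ⟩
      sumℕ r (λ j → frob e (frob (j Nat.* e) y)) ≈⟨ sumℕ-cong r (λ j → trans (frob-∘ e (j Nat.* e) y) (^-congʳ y (≡.cong (q Nat.^_) (ℕP.+-comm (j Nat.* e) e)))) ⟩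
      sumℕ r (λ j → frob (suc j Nat.* e) y)      ≈⟨ sumℕ-rotate r (λ j → frob (j Nat.* e) y) (trans (^-congʳ y (≡.cong (q Nat.^_) (≡.sym n≡r*e))) (trans (frob-n y) (sym (frob-0 y)))) ⟩
      T y                                       ∎

    vanish : ∀ y → sumℕ (double r) (λ m → sign m * y ^ (q Nat.^ exponent m)) ≈ 0#
    vanish y = begin
      sumℕ (double r) (λ m → sign m * y ^ (q Nat.^ exponent m))     ≈⟨ sumℕ-pairs r _ ⟩
      sumℕ r (λ j → sign (double j) * y ^ (q Nat.^ exponent (double j)) + sign (suc (double j)) * y ^ (q Nat.^ exponent (suc (double j))))
        ≈⟨ sumℕ-cong r (λ j → +-cong (trans (*-cong (reflexive (sign-even j)) (^-congʳ y (≡.cong (q Nat.^_) (exponent-even j)))) (-1*x≈-x _))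
                                     (trans (*-cong (reflexive (sign-odd j)) (^-congʳ y (≡.cong (q Nat.^_) (exponent-odd j)))) (*-identityˡ _))) ⟩
      sumℕ r (λ j → - frob (j Nat.* e) y + frob (j Nat.* e Nat.+ g) y) ≈⟨ sumℕ-distrib-+ r _ _ ⟩
      sumℕ r (λ j → - frob (j Nat.* e) y) + sumℕ r (λ j → frob (j Nat.* e Nat.+ g) y)
        ≈⟨ +-cong (sumℕ-neg r _) (sumℕ-cong r (λ j → sym (frob-∘ g (j Nat.* e) y))) ⟩
      - T y + sumℕ r (λ j → frob g (frob (j Nat.* e) y)) ≈⟨ +-congˡ (frob-sumℕ g r _) ⟨
      - T y + frob g (T y)                               ≈⟨ +-congˡ (Fixed[e]⊆Fixed[g] (T y) (T-Fixed y)) ⟩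
      - T y + T y                                        ≈⟨ -‿inverseˡ _ ⟩
      0#                                                 ∎

    0<double[r] : 0 < double r
    0<double[r] = positive r n≡r*e
      where
      positive : ∀ r′ → n ≡ r′ Nat.* e → 0 < double r′
      positive zero    n≡0 = ⊥-elim (Nat.≢-nonZero⁻¹ n n≡0)
      positive (suc _) _   = s≤s z≤n

    -1≈0 : - 1# ≈ 0#
    -1≈0 = sparse-vanishing⇒coeff≈0 sign (λ m → q Nat.^ exponent m) (q^-mono ∘ exponent-mono) (double r)
             (ℕP.≤-reflexive (≡.cong (q Nat.^_) (≡.trans (exponent-even r) (≡.sym n≡r*e)))) vanish 0 0<double[r]

-- Index arithmetic in ℤ_n, with n = 1 + n′

module ModularIndices (n′ : ℕ) where
  open import Data.Nat.Solver using (module +-*-Solver)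
  open +-*-Solver using (solve; _:+_; _:*_; _:=_; con)

  n : ℕ
  n = suc n′

  -- m ↦ -m in ℤ_n
  opp : ℕ → ℕ
  opp m = n′ Nat.* m

  %-congˡ-+ : ∀ a a′ b → a % n ≡ a′ % n → (a Nat.+ b) % n ≡ (a′ Nat.+ b) % n
  %-congˡ-+ a a′ b a≡a′ = ≡.trans (ℕDM.%-distribˡ-+ a b n)
    (≡.trans (≡.cong (λ z → (z Nat.+ b % n) % n) a≡a′) (≡.sym (ℕDM.%-distribˡ-+ a′ b n)))

  toℕ-mod : ∀ m → toℕ (m mod n) ≡ m % n
  toℕ-mod m = FinP.toℕ-fromℕ< _

  mod-cong : ∀ x y → x % n ≡ y % n → x mod n ≡ y mod n
  mod-cong x y x≡y = FinP.toℕ-injective (≡.trans (toℕ-mod x) (≡.trans x≡y (≡.sym (toℕ-mod y))))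

  toℕ-mod-inverse : ∀ (i : Fin n) → toℕ i mod n ≡ i
  toℕ-mod-inverse i = FinP.toℕ-injective (≡.trans (toℕ-mod (toℕ i)) (ℕDM.m<n⇒m%n≡m (FinP.toℕ<n i)))

  [i+s]-i≡s : ∀ i s → ((i Nat.+ s) % n Nat.+ (n Nat.∸ i % n)) % n ≡ s % n
  [i+s]-i≡s i s = ≡.trans (%-congˡ-+ ((i Nat.+ s) % n) (i Nat.+ s) (n Nat.∸ i % n) (ℕDM.m%n%n≡m%n (i Nat.+ s) n))
                    (≡.trans (≡.cong (_% n) eq) (ℕDM.[m+kn]%n≡m%n s (suc (i / n)) n))
    where
    r = i % n
    t = i / n
    r+[n∸r]≡n : r Nat.+ (n Nat.∸ r) ≡ n
    r+[n∸r]≡n = ℕP.m+[n∸m]≡n (ℕP.<⇒≤ (ℕDM.m%n<n i n))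
    rearrange : ∀ r t s w → (r Nat.+ t Nat.* n Nat.+ s) Nat.+ w ≡ s Nat.+ ((r Nat.+ w) Nat.+ t Nat.* n)
    rearrange = solve 4 (λ r t s w → (r :+ t :* con n :+ s) :+ w := s :+ ((r :+ w) :+ t :* con n)) ≡.refl
    eq : (i Nat.+ s) Nat.+ (n Nat.∸ r) ≡ s Nat.+ suc t Nat.* n
    eq = ≡.trans (≡.cong (λ z → (z Nat.+ s) Nat.+ (n Nat.∸ r)) (ℕDM.m≡m%n+[m/n]*n i n))
           (≡.trans (rearrange r t s (n Nat.∸ r)) (≡.cong (λ z → s Nat.+ (z Nat.+ t Nat.* n)) r+[n∸r]≡n))

  [j-i]+i≡j : ∀ j i → i ≤ n → ((j Nat.+ (n Nat.∸ i)) % n Nat.+ i) % n ≡ j % n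
  [j-i]+i≡j j i i≤n = ≡.trans (%-congˡ-+ ((j Nat.+ (n Nat.∸ i)) % n) (j Nat.+ (n Nat.∸ i)) i (ℕDM.m%n%n≡m%n (j Nat.+ (n Nat.∸ i)) n))
    (≡.trans (≡.cong (_% n) (≡.trans (ℕP.+-assoc j (n Nat.∸ i) i) (≡.cong (j Nat.+_) (ℕP.m∸n+n≡m i≤n))))
             (ℕDM.[m+n]%n≡m%n j n))

  opp[s+m]+s≡opp[m] : ∀ s m → (opp (s Nat.+ m) Nat.+ s) % n ≡ opp m % n
  opp[s+m]+s≡opp[m] s m = ≡.trans (≡.cong (_% n) eq) (ℕDM.[m+kn]%n≡m%n (opp m) s n)
    where
    eq : opp (s Nat.+ m) Nat.+ s ≡ opp m Nat.+ s Nat.* n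
    eq = solve 3 (λ n′ s m → n′ :* (s :+ m) :+ s := n′ :* m :+ s :* (con 1 :+ n′)) ≡.refl n′ s m

  opp[m+n]≡opp[m] : ∀ s m → (opp (m Nat.+ n) Nat.+ s) % n ≡ (opp m Nat.+ s) % n
  opp[m+n]≡opp[m] s m = ≡.trans (≡.cong (_% n) eq) (ℕDM.[m+kn]%n≡m%n (opp m Nat.+ s) n′ n)
    where
    eq : opp (m Nat.+ n) Nat.+ s ≡ (opp m Nat.+ s) Nat.+ n′ Nat.* n
    eq = solve 3 (λ n′ s m → n′ :* (m :+ (con 1 :+ n′)) :+ s := (n′ :* m :+ s) :+ n′ :* (con 1 :+ n′)) ≡.refl n′ s m

  opp[m]+m≡m*n : ∀ m → opp m Nat.+ m ≡ m Nat.* n Nat.+ 0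
  opp[m]+m≡m*n m = solve 2 (λ n′ m → n′ :* m :+ m := m :* (con 1 :+ n′) :+ con 0) ≡.refl n′ m

module DiagonalMatrices {c ℓ} (F : Field c ℓ) (n : ℕ) where
  open Field F
  open FieldProperties F

  identityM-diagonal : ∀ i → identityM F {n} i i ≈ 1#
  identityM-diagonal i with i Fin.≟ i
  ... | yes _   = refl
  ... | no i≢i = ⊥-elim (i≢i ≡.refl)

  identityM-offDiagonal : ∀ {i j} → i ≢ j → identityM F {n} i j ≈ 0#
  identityM-offDiagonal {i} {j} i≢j with i Fin.≟ j
  ... | yes i≡j = ⊥-elim (i≢j i≡j)
  ... | no  _   = refl

  diag-diagonal : ∀ (v : Fin n → Carrier) i → diag F v i i ≈ v i
  diag-diagonal v i with i Fin.≟ i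
  ... | yes _   = refl
  ... | no i≢i = ⊥-elim (i≢i ≡.refl)

  diag-isDiagonal : ∀ (v : Fin n → Carrier) → IsDiagonal F (diag F v)
  diag-isDiagonal v i j i≢j with i Fin.≟ j
  ... | yes i≡j = ⊥-elim (i≢j i≡j)
  ... | no  _   = refl

  *M-diagonalʳ : ∀ (X D : Matrix F n) → IsDiagonal F D → ∀ i j → _*M_ F X D i j ≈ X i j * D j j
  *M-diagonalʳ X D D-diag i j = sumF-singleton n (λ k → X i k * D k j) j (λ k k≢j → trans (*-congˡ (D-diag k j k≢j)) (zeroʳ _))

  *M-diagonalˡ : ∀ (D X : Matrix F n) → IsDiagonal F D → ∀ i j → _*M_ F D X i j ≈ D i i * X i j
  *M-diagonalˡ D X D-diag i j = sumF-singleton n (λ k → D i k * X k j) i (λ k k≢i → trans (*-congʳ (D-diag i k (k≢i ∘ ≡.sym))) (zeroˡ _))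

  *M-diagonal-sandwich : ∀ (P X Q : Matrix F n) → IsDiagonal F P → IsDiagonal F Q →
                         ∀ i j → _*M_ F (_*M_ F P X) Q i j ≈ (P i i * X i j) * Q j j
  *M-diagonal-sandwich P X Q P-diag Q-diag i j = trans (*M-diagonalʳ (_*M_ F P X) Q Q-diag i j) (*-congʳ (*M-diagonalˡ P X P-diag i j))

  module DiagonalInverse {D D⁻¹ : Matrix F n} (D-diag : IsDiagonal F D) (D*D⁻¹≈I : _≈M_ F (_*M_ F D D⁻¹) (identityM F)) where

    diagonal*inverse : ∀ i j → D i i * D⁻¹ i j ≈ identityM F i j
    diagonal*inverse i j = trans (sym (*M-diagonalˡ D D⁻¹ D-diag i j)) (D*D⁻¹≈I i j)

    diagonal-≉0 : ∀ i → D i i ≉ 0#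
    diagonal-≉0 i Dii≈0 = 1≉0 (trans (sym (trans (diagonal*inverse i i) (identityM-diagonal i))) (trans (*-congʳ Dii≈0) (zeroˡ _)))

    inverse-isDiagonal : IsDiagonal F D⁻¹
    inverse-isDiagonal i j i≢j = x*y≈0⇒y≈0 (diagonal-≉0 i) (trans (diagonal*inverse i j) (identityM-offDiagonal i≢j))

    inverse-diagonal : ∀ i → D i i * D⁻¹ i i ≈ 1#
    inverse-diagonal i = trans (diagonal*inverse i i) (identityM-diagonal i)

-- Dickson matrices and linearized polynomials over F_(q^n), with n = 1 + n′

module Dickson {c ℓ} (F : Field c ℓ) {p k : ℕ} (n′ : ℕ) (p-prime : Prime p) (1≤k : 1 ≤ k)
               (card : HasCardinality F ((p Nat.^ k) Nat.^ suc n′)) where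
  open Field F
  open FieldProperties F
  open ModularIndices n′
  open Frobenius F n p-prime 1≤k card
  open DiagonalMatrices F n
  open import Algebra.Properties.Monoid.Sum +-monoid using (sum-cong-≋)
  open import Relation.Binary.Reasoning.Setoid setoid
  import Algebra.Solver.CommutativeMonoid *-commutativeMonoid as *-Solver
  open *-Solver using (_⊕_; _⊜_)

  dick : (Fin n → Carrier) → Matrix F n
  dick = dickson F q n

  lin : (Fin n → Carrier) → Carrier → Carrier
  lin = linPoly F q n

  extend : (Fin n → Carrier) → ℕ → Carrier
  extend a m = a (m mod n)

  extend-cong : ∀ a x y → x % n ≡ y % n → extend a x ≡ extend a y
  extend-cong a x y x≡y = ≡.cong a (mod-cong x y x≡y)

  extend-toℕ : ∀ a i → extend a (toℕ i) ≡ a i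
  extend-toℕ a i = ≡.cong a (toℕ-mod-inverse i)

  lin≈sumℕ : ∀ a x → lin a x ≈ sumℕ n (λ m → extend a m * frob m x)
  lin≈sumℕ a x = sumF≈sumℕ n (λ i → a i * frob (toℕ i) x) (λ m → extend a m * frob m x) (λ i → *-congʳ (reflexive (≡.sym (extend-toℕ a i))))

  lin-cong : ∀ a {x y} → x ≈ y → lin a x ≈ lin a y
  lin-cong a {x} {y} x≈y = sum-cong-≋ {n} {λ i → a i * frob (toℕ i) x} {λ i → a i * frob (toℕ i) y} (λ i → *-congˡ (frob-cong (toℕ i) x≈y))

  lin-+ : ∀ a x y → lin a (x + y) ≈ lin a x + lin a y
  lin-+ a x y = begin
    lin a (x + y)                                                   ≈⟨ lin≈sumℕ a (x + y) ⟩
    sumℕ n (λ m → extend a m * frob m (x + y))                      ≈⟨ sumℕ-cong n {λ m → extend a m * frob m (x + y)} (λ m → trans (*-congˡ (frob-+ m x y)) (distribˡ _ _ _)) ⟩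
    sumℕ n (λ m → extend a m * frob m x + extend a m * frob m y)    ≈⟨ sumℕ-distrib-+ n (λ m → extend a m * frob m x) (λ m → extend a m * frob m y) ⟩
    sumℕ n (λ m → extend a m * frob m x) + sumℕ n (λ m → extend a m * frob m y) ≈⟨ +-cong (lin≈sumℕ a x) (lin≈sumℕ a y) ⟨
    lin a x + lin a y                                               ∎

  subMod≡ : ∀ (i j : Fin n) → toℕ (subMod F q n j i) ≡ (toℕ j Nat.+ (n Nat.∸ toℕ i)) % n
  subMod≡ i j = toℕ-mod (toℕ j Nat.+ (n Nat.∸ toℕ i))

  module Twist (a b : Fin n → Carrier) (λ′ : Carrier) (λ′≉0 : λ′ ≉ 0#)
               (twist : ∀ s → extend b s * λ′ ≈ extend a s * frob s λ′) where

    twist⇒dickson : _≈M_ F (dick b) (_*M_ F (_*M_ F (frobDiagInv F q n λ′) (dick a)) (frobDiag F q n λ′))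
    twist⇒dickson i j = begin
      frob I (b s)                                      ≈⟨ x*y≈z⇒x≈y⁻¹*z (frob-≉0 I λ′≉0) twist-ij ⟩
      frob I λ′ ⁻¹ * (frob I (a s) * frob J λ′)         ≈⟨ *-assoc _ _ _ ⟨
      (frob I λ′ ⁻¹ * dick a i j) * frob J λ′           ≈⟨ *-cong (*-congʳ (diag-diagonal _ i)) (diag-diagonal _ j) ⟨
      (frobDiagInv F q n λ′ i i * dick a i j) * frobDiag F q n λ′ j j
        ≈⟨ *M-diagonal-sandwich (frobDiagInv F q n λ′) (dick a) (frobDiag F q n λ′) (diag-isDiagonal _) (diag-isDiagonal _) i j ⟨
      _*M_ F (_*M_ F (frobDiagInv F q n λ′) (dick a)) (frobDiag F q n λ′) i j ∎
      where
      I = toℕ i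
      J = toℕ j
      s = subMod F q n j i
      twist-s : b s * λ′ ≈ a s * frob (toℕ s) λ′
      twist-s = trans (*-congʳ (reflexive (≡.sym (extend-toℕ b s)))) (trans (twist (toℕ s)) (*-congʳ (reflexive (extend-toℕ a s))))
      s+I≡J : (toℕ s Nat.+ I) % n ≡ J % n
      s+I≡J = ≡.trans (≡.cong (λ z → (z Nat.+ I) % n) (subMod≡ i j)) ([j-i]+i≡j J I (ℕP.<⇒≤ (FinP.toℕ<n i)))
      twist-ij : frob I (b s) * frob I λ′ ≈ frob I (a s) * frob J λ′
      twist-ij = begin
        frob I (b s) * frob I λ′             ≈⟨ frob-* I _ _ ⟨
        frob I (b s * λ′)                    ≈⟨ frob-cong I twist-s ⟩
        frob I (a s * frob (toℕ s) λ′)       ≈⟨ frob-* I _ _ ⟩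
        frob I (a s) * frob I (frob (toℕ s) λ′) ≈⟨ *-congˡ (frob-∘ I (toℕ s) λ′) ⟩
        frob I (a s) * frob (toℕ s Nat.+ I) λ′  ≈⟨ *-congˡ (frob-cong-% (toℕ s Nat.+ I) J λ′ s+I≡J) ⟩
        frob I (a s) * frob J λ′             ∎

    twist⇒lin : ∀ x → lin b x ≈ λ′ ⁻¹ * lin a (λ′ * x)
    twist⇒lin x = begin
      lin b x                                                 ≈⟨ lin≈sumℕ b x ⟩
      sumℕ n (λ m → extend b m * frob m x)                    ≈⟨ sumℕ-cong n {λ m → extend b m * frob m x} term ⟩
      sumℕ n (λ m → λ′ ⁻¹ * (extend a m * frob m (λ′ * x)))   ≈⟨ *-distribˡ-sumℕ n (λ′ ⁻¹) (λ m → extend a m * frob m (λ′ * x)) ⟨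
      λ′ ⁻¹ * sumℕ n (λ m → extend a m * frob m (λ′ * x))     ≈⟨ *-congˡ (lin≈sumℕ a (λ′ * x)) ⟨
      λ′ ⁻¹ * lin a (λ′ * x)                                  ∎
      where
      term : ∀ m → extend b m * frob m x ≈ λ′ ⁻¹ * (extend a m * frob m (λ′ * x))
      term m = begin
        extend b m * frob m x                            ≈⟨ *-identityˡ _ ⟨
        1# * (extend b m * frob m x)                     ≈⟨ *-congʳ (inverseˡ λ′ λ′≉0) ⟨
        (λ′ ⁻¹ * λ′) * (extend b m * frob m x)           ≈⟨ *-Solver.solve 4 (λ u v w z → (u ⊕ v) ⊕ (w ⊕ z) ⊜ u ⊕ ((w ⊕ v) ⊕ z)) refl (λ′ ⁻¹) λ′ (extend b m) (frob m x) ⟩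
        λ′ ⁻¹ * ((extend b m * λ′) * frob m x)           ≈⟨ *-congˡ (*-congʳ (twist m)) ⟩
        λ′ ⁻¹ * ((extend a m * frob m λ′) * frob m x)    ≈⟨ *-congˡ (*-assoc _ _ _) ⟩
        λ′ ⁻¹ * (extend a m * (frob m λ′ * frob m x))    ≈⟨ *-congˡ (*-congˡ (frob-* m λ′ x)) ⟨
        λ′ ⁻¹ * (extend a m * frob m (λ′ * x))           ∎

  frob-opp : ∀ m x → frob m (frob (opp m) x) ≈ x
  frob-opp m x = trans (frob-∘ m (opp m) x) (trans (^-congʳ x (≡.cong (q Nat.^_) (opp[m]+m≡m*n m))) (trans (frob-periodic m 0 x) (frob-0 x)))

  -- Given B = D⁻¹ A D, λ is taken among the  λ(θ) = Σ_m (d_(-m) θ)^(q^m);  as a sparse polynomial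
  -- in θ its coefficient of θ is d_0 ≉ 0, so some λ(θ) ≉ 0.  The relation  d_i b_s^(q^i) = a_s^(q^i) d_(i+s)
  -- then yields  b_s λ = a_s λ^(q^s)  after reindexing the sum by s.
  module FromDiagonalSimilarity (a b : Fin n → Carrier) (D D⁻¹ : Matrix F n) (D-diag : IsDiagonal F D)
                                (D*D⁻¹≈I : _≈M_ F (_*M_ F D D⁻¹) (identityM F))
                                (B≈D⁻¹AD : _≈M_ F (dick b) (_*M_ F (_*M_ F D⁻¹ (dick a)) D)) where
    open DiagonalInverse {D} {D⁻¹} D-diag D*D⁻¹≈I

    d : Fin n → Carrier
    d i = D i i

    d-twist : ∀ i j → d i * dick b i j ≈ dick a i j * d j
    d-twist i j = begin
      d i * dick b i j                              ≈⟨ *-congˡ (B≈D⁻¹AD i j) ⟩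
      d i * _*M_ F (_*M_ F D⁻¹ (dick a)) D i j      ≈⟨ *-congˡ (*M-diagonal-sandwich D⁻¹ (dick a) D inverse-isDiagonal D-diag i j) ⟩
      d i * ((D⁻¹ i i * dick a i j) * d j)          ≈⟨ *-Solver.solve 4 (λ x y z w → x ⊕ ((y ⊕ z) ⊕ w) ⊜ ((x ⊕ y) ⊕ z) ⊕ w) refl (d i) (D⁻¹ i i) (dick a i j) (d j) ⟩
      ((d i * D⁻¹ i i) * dick a i j) * d j          ≈⟨ *-congʳ (*-congʳ (inverse-diagonal i)) ⟩
      (1# * dick a i j) * d j                       ≈⟨ *-congʳ (*-identityˡ _) ⟩
      dick a i j * d j                              ∎

    d-twistℕ : ∀ i s → extend d i * frob i (extend b s) ≈ frob i (extend a s) * extend d (i Nat.+ s)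
    d-twistℕ i s = begin
      extend d i * frob i (extend b s)   ≈⟨ *-congˡ (frob-cong-% (toℕ I) i (extend b s) I≡i) ⟨
      d I * frob (toℕ I) (b (s mod n))   ≡⟨ ≡.cong (λ z → d I * frob (toℕ I) (b z)) (≡.sym J-I≡s) ⟩
      d I * dick b I J                   ≈⟨ d-twist I J ⟩
      dick a I J * d J                   ≡⟨ ≡.cong (λ z → frob (toℕ I) (a z) * d J) J-I≡s ⟩
      frob (toℕ I) (a (s mod n)) * d J   ≈⟨ *-congʳ (frob-cong-% (toℕ I) i (extend a s) I≡i) ⟩
      frob i (extend a s) * extend d (i Nat.+ s) ∎
      where
      I = i mod n
      J = (i Nat.+ s) mod n
      I≡i : toℕ I % n ≡ i % n
      I≡i = ≡.trans (≡.cong (_% n) (toℕ-mod i)) (ℕDM.m%n%n≡m%n i n)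
      J-I≡s : subMod F q n J I ≡ s mod n
      J-I≡s = FinP.toℕ-injective (≡.trans (subMod≡ I J)
        (≡.trans (≡.cong₂ (λ y z → (y Nat.+ (n Nat.∸ z)) % n) (toℕ-mod (i Nat.+ s)) (toℕ-mod i))
          (≡.trans ([i+s]-i≡s i s) (≡.sym (toℕ-mod s)))))

    coefficient : ℕ → Carrier
    coefficient m = frob m (extend d (opp m))

    trace : Carrier → Carrier
    trace θ = sumℕ n (λ m → coefficient m * frob m θ)

    trace-cong : ∀ {x y} → x ≈ y → trace x ≈ trace y
    trace-cong {x} {y} x≈y = sumℕ-cong n {λ m → coefficient m * frob m x} (λ m → *-congˡ (frob-cong m x≈y))

    ∃trace≉0 : Σ Carrier (λ θ → trace θ ≉ 0#)
    ∃trace≉0 = ∃≉0 trace trace-cong (λ trace≈0 → frob-≉0 0 (diagonal-≉0 (opp 0 mod n))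
      (sparse-vanishing⇒coeff≈0 coefficient (q Nat.^_) (λ m → q^-mono (ℕP.n<1+n m)) n ℕP.≤-refl trace≈0 0 (s≤s z≤n)))

    λ′ : Carrier
    λ′ = trace (proj₁ ∃trace≉0)

    λ′≉0 : λ′ ≉ 0#
    λ′≉0 = proj₂ ∃trace≉0

    twist : ∀ s → extend b s * λ′ ≈ extend a s * frob s λ′
    twist s = begin
      extend b s * λ′                                   ≈⟨ *-distribˡ-sumℕ n (extend b s) (λ m → coefficient m * frob m θ) ⟩
      sumℕ n (λ m → extend b s * (coefficient m * frob m θ)) ≈⟨ sumℕ-cong n term ⟩
      sumℕ n (λ m → extend a s * G m)                   ≈⟨ *-distribˡ-sumℕ n (extend a s) G ⟨
      extend a s * sumℕ n G                             ≈⟨ *-congˡ (sumℕ-shift n s G G-periodic) ⟨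
      extend a s * sumℕ n (λ m → G (s Nat.+ m))         ≈⟨ *-congˡ (sumℕ-cong n shifted-term) ⟩
      extend a s * sumℕ n (λ m → frob s (coefficient m * frob m θ)) ≈⟨ *-congˡ (frob-sumℕ s n (λ m → coefficient m * frob m θ)) ⟨
      extend a s * frob s λ′                            ∎
      where
      θ = proj₁ ∃trace≉0
      G : ℕ → Carrier
      G m = frob m (θ * extend d (opp m Nat.+ s))
      term : ∀ m → extend b s * (coefficient m * frob m θ) ≈ extend a s * G m
      term m = begin
        extend b s * (coefficient m * frob m θ)                       ≈⟨ *-Solver.solve 3 (λ x y z → x ⊕ (y ⊕ z) ⊜ z ⊕ (y ⊕ x)) refl (extend b s) (coefficient m) (frob m θ) ⟩
        frob m θ * (coefficient m * extend b s)                       ≈⟨ *-congˡ (*-congˡ (frob-opp m (extend b s))) ⟨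
        frob m θ * (coefficient m * frob m (frob (opp m) (extend b s))) ≈⟨ *-congˡ (frob-* m _ _) ⟨
        frob m θ * frob m (extend d (opp m) * frob (opp m) (extend b s)) ≈⟨ *-congˡ (frob-cong m (d-twistℕ (opp m) s)) ⟩
        frob m θ * frob m (frob (opp m) (extend a s) * extend d (opp m Nat.+ s)) ≈⟨ *-congˡ (frob-* m _ _) ⟩
        frob m θ * (frob m (frob (opp m) (extend a s)) * frob m (extend d (opp m Nat.+ s))) ≈⟨ *-congˡ (*-congʳ (frob-opp m (extend a s))) ⟩
        frob m θ * (extend a s * frob m (extend d (opp m Nat.+ s)))   ≈⟨ *-Solver.solve 3 (λ x y z → x ⊕ (y ⊕ z) ⊜ y ⊕ (x ⊕ z)) refl (frob m θ) (extend a s) _ ⟩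
        extend a s * (frob m θ * frob m (extend d (opp m Nat.+ s)))   ≈⟨ *-congˡ (frob-* m _ _) ⟨
        extend a s * G m                                              ∎
      G-periodic : ∀ m → G (m Nat.+ n) ≈ G m
      G-periodic m = trans (frob-cong (m Nat.+ n) (*-congˡ (reflexive (extend-cong d (opp (m Nat.+ n) Nat.+ s) (opp m Nat.+ s) (opp[m+n]≡opp[m] s m)))))
                           (frob-cong-% (m Nat.+ n) m (θ * extend d (opp m Nat.+ s)) (ℕDM.[m+n]%n≡m%n m n))
      shifted-term : ∀ m → G (s Nat.+ m) ≈ frob s (coefficient m * frob m θ)
      shifted-term m = begin
        frob (s Nat.+ m) (θ * extend d (opp (s Nat.+ m) Nat.+ s)) ≈⟨ frob-cong (s Nat.+ m) (*-congˡ (reflexive (extend-cong d (opp (s Nat.+ m) Nat.+ s) (opp m) (opp[s+m]+s≡opp[m] s m)))) ⟩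
        frob (s Nat.+ m) (θ * extend d (opp m))                   ≈⟨ ^-congʳ _ (≡.cong (q Nat.^_) (ℕP.+-comm s m)) ⟩
        frob (m Nat.+ s) (θ * extend d (opp m))                   ≈⟨ frob-∘ s m _ ⟨
        frob s (frob m (θ * extend d (opp m)))                    ≈⟨ frob-cong s (frob-* m θ _) ⟩
        frob s (frob m θ * coefficient m)                         ≈⟨ frob-cong s (*-comm _ _) ⟩
        frob s (coefficient m * frob m θ)                         ∎

  -- The defect of the scalar c from commuting with f = lin a, coefficient by coefficient.
  module Linearity (a : Fin n → Carrier) where
    open import Algebra.Properties.Ring ring using (-‿distribʳ-*; -‿distribˡ-*)

    f : Carrier → Carrier
    f = lin a

    defect : Carrier → ℕ → Carrier
    defect c m = extend a m * (frob m c - c)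

    f[c*y]≈ : ∀ c y → f (c * y) ≈ sumℕ n (λ m → defect c m * frob m y) + c * f y
    f[c*y]≈ c y = begin
      f (c * y)                                                    ≈⟨ lin≈sumℕ a (c * y) ⟩
      sumℕ n (λ m → extend a m * frob m (c * y))
        ≈⟨ sumℕ-cong n {λ m → extend a m * frob m (c * y)} (λ m → trans (*-congˡ (frob-* m c y)) (split (extend a m) (frob m c) (frob m y))) ⟩
      sumℕ n (λ m → defect c m * frob m y + c * (extend a m * frob m y))
        ≈⟨ sumℕ-distrib-+ n (λ m → defect c m * frob m y) (λ m → c * (extend a m * frob m y)) ⟩
      sumℕ n (λ m → defect c m * frob m y) + sumℕ n (λ m → c * (extend a m * frob m y))
        ≈⟨ +-congˡ (*-distribˡ-sumℕ n c (λ m → extend a m * frob m y)) ⟨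
      sumℕ n (λ m → defect c m * frob m y) + c * sumℕ n (λ m → extend a m * frob m y) ≈⟨ +-congˡ (*-congˡ (lin≈sumℕ a y)) ⟨
      sumℕ n (λ m → defect c m * frob m y) + c * f y               ∎
      where
      split : ∀ A g Y → A * (g * Y) ≈ (A * (g - c)) * Y + c * (A * Y)
      split A g Y = sym (begin
        (A * (g - c)) * Y + c * (A * Y)                ≈⟨ +-congʳ (*-congʳ (distribˡ A g (- c))) ⟩
        (A * g + A * - c) * Y + c * (A * Y)            ≈⟨ +-congʳ (distribʳ Y (A * g) (A * - c)) ⟩
        ((A * g) * Y + (A * - c) * Y) + c * (A * Y)    ≈⟨ +-assoc _ _ _ ⟩
        (A * g) * Y + ((A * - c) * Y + c * (A * Y))    ≈⟨ +-congˡ (+-congʳ A*-c*Y≈-[c*[A*Y]]) ⟩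
        (A * g) * Y + (- (c * (A * Y)) + c * (A * Y))  ≈⟨ +-congˡ (-‿inverseˡ _) ⟩
        (A * g) * Y + 0#                               ≈⟨ +-identityʳ _ ⟩
        (A * g) * Y                                    ≈⟨ *-assoc _ _ _ ⟩
        A * (g * Y)                                    ∎)
        where
        A*-c*Y≈-[c*[A*Y]] : (A * - c) * Y ≈ - (c * (A * Y))
        A*-c*Y≈-[c*[A*Y]] = begin
          (A * - c) * Y   ≈⟨ *-congʳ (-‿distribʳ-* A c) ⟨
          (- (A * c)) * Y ≈⟨ -‿distribˡ-* (A * c) Y ⟨
          - ((A * c) * Y) ≈⟨ -‿cong (*-Solver.solve 3 (λ x y z → (x ⊕ y) ⊕ z ⊜ y ⊕ (x ⊕ z)) refl A c Y) ⟩
          - (c * (A * Y)) ∎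

    scalar⇒defect≈0 : ∀ c → (∀ y → f (c * y) ≈ c * f y) → ∀ m → m < n → defect c m ≈ 0#
    scalar⇒defect≈0 c scalar = sparse-vanishing⇒coeff≈0 (defect c) (q Nat.^_) (λ m → q^-mono (ℕP.n<1+n m)) n ℕP.≤-refl vanish
      where
      vanish : ∀ y → sumℕ n (λ m → defect c m * frob m y) ≈ 0#
      vanish y = +-cancelˡ (trans (+-comm _ _) (trans (sym (f[c*y]≈ c y)) (trans (scalar y) (sym (+-identityʳ _)))))

    defect≈0⇒scalar : ∀ c → (∀ m → m < n → defect c m ≈ 0#) → ∀ y → f (c * y) ≈ c * f y
    defect≈0⇒scalar c defect≈0 y = trans (f[c*y]≈ c y)
      (trans (+-congʳ (sumℕ-zero n {λ m → defect c m * frob m y} (λ m m<n → trans (*-congʳ (defect≈0 m m<n)) (zeroˡ (frob m y))))) (+-identityˡ _))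

    Fixed⇒defect≈0 : ∀ c m → Fixed m c → defect c m ≈ 0#
    Fixed⇒defect≈0 c m fixed = trans (*-congˡ (x≈y⇒x∙y⁻¹≈ε fixed)) (zeroʳ _)

    Support : ℕ → Set ℓ
    Support m = extend a m ≉ 0#

    scalar⇒Fixed : ∀ c → (∀ y → f (c * y) ≈ c * f y) → ∀ m → m < n → Support m → Fixed m c
    scalar⇒Fixed c scalar m m<n supported = x-y≈0⇒x≈y (x*y≈0⇒y≈0 supported (scalar⇒defect≈0 c scalar m m<n))

    supportGcd : ℕ → ℕ
    supportGcd zero = n
    supportGcd (suc m) with extend a m ≟ 0#
    ... | yes _ = supportGcd m
    ... | no  _ = gcd (supportGcd m) m

    supportGcd∣n : ∀ m → supportGcd m ∣ n
    supportGcd∣n zero = ℕD.∣-refl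
    supportGcd∣n (suc m) with extend a m ≟ 0#
    ... | yes _ = supportGcd∣n m
    ... | no  _ = ℕD.∣-trans (gcd[m,n]∣m (supportGcd m) m) (supportGcd∣n m)

    supportGcd∣support : ∀ m i → i < m → Support i → supportGcd m ∣ i
    supportGcd∣support (suc m) i i<1+m supported with extend a m ≟ 0# | ℕP.m<1+n⇒m<n∨m≡n i<1+m
    ... | yes _   | inj₁ i<m    = supportGcd∣support m i i<m supported
    ... | yes a≈0 | inj₂ ≡.refl = ⊥-elim (supported a≈0)
    ... | no  _   | inj₁ i<m    = ℕD.∣-trans (gcd[m,n]∣m (supportGcd m) m) (supportGcd∣support m i i<m supported)
    ... | no  _   | inj₂ ≡.refl = gcd[m,n]∣n (supportGcd m) m

    ∣supportGcd : ∀ m g → g ∣ n → (∀ i → i < m → Support i → g ∣ i) → g ∣ supportGcd m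
    ∣supportGcd zero    g g∣n _        = g∣n
    ∣supportGcd (suc m) g g∣n g∣support with extend a m ≟ 0#
    ... | yes _         = ∣supportGcd m g g∣n (λ i i<m → g∣support i (ℕP.m<n⇒m<1+n i<m))
    ... | no  supported = gcd-greatest (∣supportGcd m g g∣n (λ i i<m → g∣support i (ℕP.m<n⇒m<1+n i<m))) (g∣support m (ℕP.n<1+n m) supported)

    supportGcd-Fixed : ∀ m x → (∀ i → i < m → Support i → Fixed i x) → Fixed (supportGcd m) x
    supportGcd-Fixed zero    x _       = frob-n x
    supportGcd-Fixed (suc m) x fixed with extend a m ≟ 0#
    ... | yes _         = supportGcd-Fixed m x (λ i i<m → fixed i (ℕP.m<n⇒m<1+n i<m))
    ... | no  supported = Fixed-gcd (supportGcd m) m x (supportGcd-Fixed m x (λ i i<m → fixed i (ℕP.m<n⇒m<1+n i<m))) (fixed m (ℕP.n<1+n m) supported)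

    Fixed[supportGcd]⇒scalar : ∀ c → Fixed (supportGcd n) c → ∀ y → f (c * y) ≈ c * f y
    Fixed[supportGcd]⇒scalar c fixed = defect≈0⇒scalar c defect≈0
      where
      defect≈0 : ∀ m → m < n → defect c m ≈ 0#
      defect≈0 m m<n with extend a m ≟ 0#
      ... | yes a≈0       = trans (*-congʳ a≈0) (zeroˡ _)
      ... | no  supported with supportGcd∣support n m m<n supported
      ...   | divides t m≡t*h = Fixed⇒defect≈0 c m (≡.subst (λ z → Fixed z c) (≡.sym m≡t*h) (Fixed-* t (supportGcd n) c fixed))

    -- F_(q^e) ⊆ F_(q^i) for every supported i forces e ∣ i, since F_(q^e) ⊈ F_(q^gcd(e,i)) otherwise.
    maxField≡supportGcd : ∀ e → IsMaxFieldOfLinearity F q n e f → e ≡ supportGcd n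
    maxField≡supportGcd e (e∣n , f-linear[e] , e-max) = ℕP.≤-antisym (ℕD.∣⇒≤ ⦃ ∣⇒nonZero (supportGcd∣n n) ⦄ e∣h) h≤e
      where
      instance
        e≢0 : NonZero e
        e≢0 = ∣⇒nonZero e∣n
      h≤e : supportGcd n ≤ e
      h≤e = e-max (supportGcd n) (supportGcd∣n n) (lin-+ a , λ c y fixed → Fixed[supportGcd]⇒scalar c fixed y)
      e∣support : ∀ i → i < n → Support i → e ∣ i
      e∣support i i<n supported with gcd e i ℕP.<? e
      ... | yes g<e = ⊥-elim (Fixed-⊈ 1≤g g<e e∣n Fixed[e]⊆Fixed[g])
        where
        1≤g : 1 ≤ gcd e i
        1≤g = Nat.>-nonZero⁻¹ (gcd e i) ⦃ ∣⇒nonZero (gcd[m,n]∣m e i) ⦄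
        Fixed[e]⊆Fixed[g] : ∀ c → Fixed e c → Fixed (gcd e i) c
        Fixed[e]⊆Fixed[g] c fixed = Fixed-gcd e i c fixed (scalar⇒Fixed c (λ y → proj₂ f-linear[e] c y fixed) i i<n supported)
      ... | no  g≮e = ≡.subst (_∣ i) (ℕP.≤-antisym (ℕD.∣⇒≤ (gcd[m,n]∣m e i)) (ℕP.≮⇒≥ g≮e)) (gcd[m,n]∣n e i)
      e∣h : e ∣ supportGcd n
      e∣h = ∣supportGcd n e e∣n e∣support

    scalar⇒Fixed[maxField] : ∀ e → IsMaxFieldOfLinearity F q n e f → ∀ c → (∀ y → f (c * y) ≈ c * f y) → Fixed e c
    scalar⇒Fixed[maxField] e maxField c scalar = ≡.subst (λ z → Fixed z c) (≡.sym (maxField≡supportGcd e maxField))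
      (supportGcd-Fixed n c (scalar⇒Fixed c scalar))

mainTheorem12 : ∀ {c ℓ} (F : Field c ℓ) (q n : ℕ) .{{_ : NonZero n}} →
    IsPrimePower q → HasCardinality F (q Data.Nat.^ n) →
    (a b : Fin n → Field.Carrier F) →
    DiagonallySimilar F (dickson F q n a) (dickson F q n b) →
    Σ (Field.Carrier F) λ lam →
      (¬ (Field._≈_ F lam (Field.0# F)) ×
       _≈M_ F (dickson F q n b)
         (_*M_ F (_*M_ F (frobDiagInv F q n lam) (dickson F q n a)) (frobDiag F q n lam)) ×
       (∀ x → Field._≈_ F (linPoly F q n b x)
                (Field._*_ F (Field._⁻¹ F lam) (linPoly F q n a (Field._*_ F lam x))))) ×
      (∀ e → IsMaxFieldOfLinearity F q n e (linPoly F q n a) →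
             IsMaxFieldOfLinearity F q n e (linPoly F q n b) →
             ∀ mu → ¬ (Field._≈_ F mu (Field.0# F)) →
             _≈M_ F (dickson F q n b)
               (_*M_ F (_*M_ F (frobDiagInv F q n mu) (dickson F q n a)) (frobDiag F q n mu)) →
             (∀ x → Field._≈_ F (linPoly F q n b x)
                (Field._*_ F (Field._⁻¹ F mu) (linPoly F q n a (Field._*_ F mu x)))) →
             InSubfield F q n e (Field._*_ F mu (Field._⁻¹ F lam)))
mainTheorem12 F .(p Nat.^ k) (suc n′) (p , k , p-prime , 1≤k , ≡.refl) card a b (D , D⁻¹ , D-diag , (D*D⁻¹≈I , _) , B≈D⁻¹AD) =
  λ′ , (λ′≉0 , twist⇒dickson , twist⇒lin) ,
  λ e maxField[f] _ μ μ≉0 _ g≈μ-conjugate →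
    scalar⇒Fixed[maxField] e maxField[f] (μ * λ′ ⁻¹)
      (conjugates⇒ratio-scalar (lin a) (lin b) (lin-cong a) λ′≉0 μ≉0 twist⇒lin g≈μ-conjugate)
  where
  open Field F using (_*_; _⁻¹)
  open FieldProperties F using (conjugates⇒ratio-scalar)
  open Dickson F n′ p-prime 1≤k card
  open FromDiagonalSimilarity a b D D⁻¹ D-diag D*D⁻¹≈I B≈D⁻¹AD
  open Twist a b λ′ λ′≉0 twist
  open Linearity a using (scalar⇒Fixed[maxField])
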